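{- Let $\mathcal{B}_X$ be an eulerian building set. Then for every composition $\alpha=(a_1,\dots,a_k)$ of $|X|$ and every $i\in\{1,\dots,k\}$, $$\sum_{j=0}^{a_i}(-1)^j\zeta_{(a_1,\dots,a_{i-1},j,a_i-j,a_{i+1},\dots,a_k)}(\mathcal{B}_X)=0,$$ where zero parts of compositions are omitted.
   Context: A building set on a finite set $X$ is a collection $\mathcal{B}$ of nonempty subsets of $X$ such that (B1) if $S,S'\in\mathcal{B}$ and $S\cap S'\neq\emptyset$ then $S\cup S'\in\mathcal{B}$, and (B2) $\{i\}\in\mathcal{B}$ for all $i\in X$. Restriction: $\mathcal{B}|_I=\{S\in\mathcal{B}:S\subset I\}$; discrete means only singletons. For a composition $\beta=(b_1,\dots,b_l)$ of $|X|$, $\zeta_\beta(\mathcal{B}_X)$ is the number of ordered decompositions $X=J_1\sqcup\dots\sqcup J_l$ with $|J_i|=b_i$ and each $\mathcal{B}_X|_{J_i}$ discrete. Let $\zeta^{ -1}$ be defined on building sets by $\zeta^{ -1}(\mathcal{B}_\emptyset)=1$ and, for $X\ne\emptyset$, $\zeta^{ -1}(\mathcal{B}_X)=\sum_{k\ge1}(-1)^kN_k$, where $N_k$ is the number of ordered decompositions $X=J_1\sqcup\dots\sqcup J_k$ into nonempty sets with each $\mathcal{B}_X|_{J_i}$ discrete (this is the convolution inverse of the character "$\mathcal{B}$ is discrete" on the Hopf algebra of building sets). A building set $\mathcal{B}_X$ is eulerian if for every $J\subset X$, either $\mathcal{B}_X|_J$ is discrete or $\zeta^{ -1}(\mathcal{B}_X|_J)=0$.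 -}

module Defs where

open import Data.Bool using (Bool; true; false; _∧_; _∨_; not; if_then_else_)
open import Data.Nat using (ℕ; zero; suc; _∸_; _≡ᵇ_; _≤ᵇ_; _<_)
open import Data.Fin using (Fin; zero; suc; toℕ)
import Data.Fin as F
open import Data.Fin.Subset using (Subset; inside; outside; _∈_; _∩_; _∪_; ⁅_⁆; ∣_∣; Nonempty; _⊆_)
open import Data.Fin.Subset.Properties using (_⊆?_)
open import Data.Vec using (Vec; []; _∷_; lookup)
import Data.Vec as V
open import Data.List using (List; []; _∷_; _++_; concatMap; length; filter; take; drop; upTo; allFin)
import Data.List as L
open import Data.List.Relation.Unary.All using (All)
open import Data.Integer using (ℤ; +_; -_; _*_) renaming (_+_ to _+ℤ_)
open import Data.Product using (_×_; Σ)
open import Relation.Nullary.Decidable using (⌊_⌋)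
open import Relation.Binary.PropositionalEquality using (_≡_)

-- Ground set X = Fin n; subsets of X are  Subset n  (stdlib).
-- A (candidate) building set is given by its decidable membership
-- predicate  B : Subset n → Bool  ("S ∈ 𝓑" iff  B S ≡ true).

IsBuildingSet : {n : ℕ} → (Subset n → Bool) → Set
IsBuildingSet {n} B =
  ((S : Subset n) → B S ≡ true → Nonempty S) ×
  ((S S' : Subset n) → B S ≡ true → B S' ≡ true →
     Nonempty (S ∩ S') → B (S ∪ S') ≡ true) ×
  ((i : Fin n) → B ⁅ i ⁆ ≡ true)

allSubsets : (n : ℕ) → List (Subset n)
allSubsets zero = [] ∷ []
allSubsets (suc n) = concatMap (λ s → (outside ∷ s) ∷ (inside ∷ s) ∷ []) (allSubsets n)

allMaps : (n l : ℕ) → List (Vec (Fin l) n)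
allMaps zero l = [] ∷ []
allMaps (suc n) l = concatMap (λ v → L.map (λ a → a ∷ v) (allFin l)) (allMaps n l)

count : {A : Set} → (A → Bool) → List A → ℕ
count p xs = length (filter (λ x → Data.Bool._≟_ (p x) true) xs)
  where import Data.Bool

allᵇ : {A : Set} → (A → Bool) → List A → Bool
allᵇ p xs = L.foldr (λ x b → p x ∧ b) true xs

-- block i of an ordered decomposition f : X → Fin l, i.e. J_i = f⁻¹(i)
block : {n l : ℕ} → Vec (Fin l) n → Fin l → Subset n
block f i = V.map (λ v → if ⌊ v F.≟ i ⌋ then inside else outside) f

discreteᵇ : {n : ℕ} → (Subset n → Bool) → Subset n → Bool
discreteᵇ {n} B J =
  allᵇ (λ S → not (B S ∧ ⌊ S ⊆? J ⌋) ∨ (∣ S ∣ ≤ᵇ 1)) (allSubsets n)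

-- ζ_β(𝓑_X) for a list β = (b_1,…,b_l): number of ordered decompositions
-- X = J_1 ⊔ … ⊔ J_l with |J_i| = b_i and each 𝓑|_{J_i} discrete.

zeta : {n : ℕ} → (Subset n → Bool) → List ℕ → ℕ
zeta {n} B β =
  count (λ f → allᵇ (λ i → (∣ block f i ∣ ≡ᵇ L.lookup β i) ∧ discreteᵇ B (block f i))
                    (allFin (length β)))
        (allMaps n (length β))

-- N_k(J): number of ordered decompositions J = J_1 ⊔ … ⊔ J_k into nonempty
-- sets with each 𝓑|_{J_i} discrete.  Encoded as maps g : X → Fin (suc k)
-- with g x = zero iff x ∉ J, and J_i = g⁻¹(suc (i-1)).

Nk : {n : ℕ} → (Subset n → Bool) → Subset n → ℕ → ℕ
Nk {n} B J k =
  count (λ g →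
          allᵇ (λ x → ⌊ lookup J x Data.Bool.≟ inside ⌋ ∧ not ⌊ lookup g x F.≟ zero ⌋
                      ∨ (⌊ lookup J x Data.Bool.≟ outside ⌋ ∧ ⌊ lookup g x F.≟ zero ⌋))
               (allFin n)
          ∧ allᵇ (λ i → not (∣ block g (suc i) ∣ ≡ᵇ 0) ∧ discreteᵇ B (block g (suc i)))
                 (allFin k))
        (allMaps n (suc k))
  where import Data.Bool

sign : ℕ → ℤ
sign zero = + 1
sign (suc k) = - sign k

-- ζ⁻¹(𝓑|_J) = 1 if J = ∅, and Σ_{k≥1} (-1)^k N_k(J) otherwise
-- (N_k(J) = 0 for k > |J|, so the sum is over 1 ≤ k ≤ |J|).
zetaInv : {n : ℕ} → (Subset n → Bool) → Subset n → ℤ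
zetaInv B J with ∣ J ∣
... | zero = + 1
... | suc m = L.foldr _+ℤ_ (+ 0) (L.map (λ k → sign (suc k) * + Nk B J (suc k)) (upTo (suc m)))

IsEulerian : {n : ℕ} → (Subset n → Bool) → Set
IsEulerian {n} B = (J : Subset n) → (discreteᵇ B J ≡ true) Data.Sum.⊎ (zetaInv B J ≡ + 0)
  where import Data.Sum

IsComposition : ℕ → List ℕ → Set
IsComposition n α = All (λ a → 0 < a) α × (Data.Nat.ListAction.sum α ≡ n)
  where import Data.Nat.ListAction

splitAt : (α : List ℕ) → Fin (length α) → ℕ → List ℕ
splitAt α i j =
  L.filter (λ a → Data.Nat._>?_ a 0)
    (take (toℕ i) α ++ j ∷ (L.lookup α i ∸ j) ∷ drop (suc (toℕ i)) α)
  where import Data.Nat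

altSum : {n : ℕ} → (Subset n → Bool) → (α : List ℕ) → Fin (length α) → ℤ
altSum B α i =
  L.foldr _+ℤ_ (+ 0)
    (L.map (λ j → sign j * + zeta B (splitAt α i j)) (upTo (suc (L.lookup α i))))

-- Let D J say that 𝓑|_J is discrete; D is hereditary and holds on ∅. Splitting the i-th block
-- into blocks A, A′ of sizes j and a_i − j and regrouping by K = A ∪ A′, the alternating sum
-- becomes Σ_{|K| = a_i} ζ(remaining parts on X ∖ K) · Σ_{A ⊆ K} (−1)^|A| D A D (K ∖ A).
-- The inner sum vanishes for K ≠ ∅. Indeed μ = ζ⁻¹ satisfies Σ_{A ⊆ U, D A} μ(U ∖ A) = 0 for U ≠ ∅,
-- and the eulerian hypothesis gives μ J = (−1)^|J| D J by induction: μ J = 0 unless J is discrete,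
-- and then all subsets are discrete and the recursion for μ J is a binomial sum. Hence
-- Σ_{A ⊆ K} (−1)^|A| D A D (K ∖ A) = (−1)^|K| Σ_{A ⊆ K, D A} μ(K ∖ A) = 0.

module Submission where

open import Data.Bool using (Bool; true; false; _∧_; _∨_; not; if_then_else_; T)
import Data.Bool as Bool
import Data.Bool.Properties as Boolₚ
open import Data.Nat using (ℕ; zero; suc; _≡ᵇ_; _≤ᵇ_; _∸_; _≤_; _<_; z≤n; s≤s)
import Data.Nat as ℕ
import Data.Nat.Properties as ℕₚ
open import Data.Fin using (Fin; zero; suc; toℕ)
import Data.Fin as Fin
import Data.Fin.Properties as Finₚ
open import Data.Fin.Subset using (Subset; inside; outside; ∣_∣; ⊥; ⊤)
open import Data.Fin.Subset.Properties using (_⊆?_; ∣p∣≤n)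
open import Data.Vec using (Vec; []; _∷_; lookup)
import Data.Vec as Vec
open import Data.List using (List; []; _∷_; _++_; concatMap; map; foldr; tabulate; allFin; upTo; applyUpTo; length; take; drop)
import Data.List as List
import Data.List.Relation.Unary.All as All
open import Data.List.Membership.Propositional.Properties using (∈-lookup)
open import Data.Integer using (ℤ; +_; -_; _*_; _+_; 0ℤ; 1ℤ)
open import Data.Integer.Properties
open import Data.Integer.Tactic.RingSolver using (solve-∀)
open import Data.Product using (_,_)
open import Data.Sum using (_⊎_; inj₂)
import Data.Sum as Sum
open import Relation.Nullary using (yes; no; contradiction)
open import Relation.Nullary.Decidable using (⌊_⌋; ⌊⌋-map′)
open import Relation.Binary.PropositionalEquality

open import Defs

∑ : {A : Set} → List A → (A → ℤ) → ℤ
∑ xs f = foldr _+_ 0ℤ (map f xs)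

syntax ∑ xs (λ x → e) = ∑[ x ← xs ] e

⟦_⟧ : Bool → ℤ
⟦ true ⟧ = 1ℤ
⟦ false ⟧ = 0ℤ

⟦∧⟧ : ∀ a b → ⟦ a ∧ b ⟧ ≡ ⟦ a ⟧ * ⟦ b ⟧
⟦∧⟧ true b = sym (*-identityˡ ⟦ b ⟧)
⟦∧⟧ false b = refl

⟦⟧*-cong : (b : Bool) {x y : ℤ} → (b ≡ true → x ≡ y) → ⟦ b ⟧ * x ≡ ⟦ b ⟧ * y
⟦⟧*-cong true eq = cong (1ℤ *_) (eq refl)
⟦⟧*-cong false {x} {y} _ = trans (*-zeroˡ x) (sym (*-zeroˡ y))

∑-cong : {A : Set} (xs : List A) {f g : A → ℤ} → (∀ x → f x ≡ g x) → ∑ xs f ≡ ∑ xs g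
∑-cong [] eq = refl
∑-cong (x ∷ xs) eq = cong₂ _+_ (eq x) (∑-cong xs eq)

∑-zero : {A : Set} (xs : List A) {f : A → ℤ} → (∀ x → f x ≡ 0ℤ) → ∑ xs f ≡ 0ℤ
∑-zero [] eq = refl
∑-zero (x ∷ xs) eq = trans (cong₂ _+_ (eq x) (∑-zero xs eq)) refl

∑-++ : {A : Set} (xs ys : List A) (f : A → ℤ) → ∑ (xs ++ ys) f ≡ ∑ xs f + ∑ ys f
∑-++ [] ys f = sym (+-identityˡ _)
∑-++ (x ∷ xs) ys f = trans (cong (_+_ (f x)) (∑-++ xs ys f)) (sym (+-assoc (f x) _ _))

∑-map : {A B : Set} (g : A → B) (xs : List A) (f : B → ℤ) → ∑ (map g xs) f ≡ ∑ xs (λ x → f (g x))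
∑-map g [] f = refl
∑-map g (x ∷ xs) f = cong (_+_ (f (g x))) (∑-map g xs f)

∑-concatMap : {A B : Set} (g : A → List B) (xs : List A) (f : B → ℤ) →
  ∑ (concatMap g xs) f ≡ ∑[ x ← xs ] ∑ (g x) f
∑-concatMap g [] f = refl
∑-concatMap g (x ∷ xs) f = trans (∑-++ (g x) (concatMap g xs) f) (cong (_+_ (∑ (g x) f)) (∑-concatMap g xs f))

∑-+ : {A : Set} (xs : List A) (f g : A → ℤ) → ∑[ x ← xs ] (f x + g x) ≡ ∑ xs f + ∑ xs g
∑-+ [] f g = refl
∑-+ (x ∷ xs) f g = trans (cong (_+_ (f x + g x)) (∑-+ xs f g)) (interchange (f x) (g x) (∑ xs f) (∑ xs g))
  where
  interchange : ∀ a b c d → a + b + (c + d) ≡ a + c + (b + d)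
  interchange = solve-∀

∑-*ˡ : {A : Set} (c : ℤ) (xs : List A) (f : A → ℤ) → ∑[ x ← xs ] (c * f x) ≡ c * ∑ xs f
∑-*ˡ c [] f = sym (*-zeroʳ c)
∑-*ˡ c (x ∷ xs) f = trans (cong (_+_ (c * f x)) (∑-*ˡ c xs f)) (sym (*-distribˡ-+ c (f x) (∑ xs f)))

∑-neg : {A : Set} (xs : List A) (f : A → ℤ) → ∑[ x ← xs ] (- f x) ≡ - ∑ xs f
∑-neg xs f = trans (∑-cong xs (λ x → sym (-1*i≡-i (f x)))) (trans (∑-*ˡ (- 1ℤ) xs f) (-1*i≡-i _))

∑-comm : {A B : Set} (xs : List A) (ys : List B) (f : A → B → ℤ) →
  ∑[ x ← xs ] ∑[ y ← ys ] f x y ≡ ∑[ y ← ys ] ∑[ x ← xs ] f x y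
∑-comm [] ys f = sym (∑-zero ys (λ _ → refl))
∑-comm (x ∷ xs) ys f =
  trans (cong (_+_ (∑ ys (f x))) (∑-comm xs ys f)) (sym (∑-+ ys (f x) (λ y → ∑[ x ← xs ] f x y)))

∑-tabulate : {A : Set} {n : ℕ} (g : Fin n → A) (f : A → ℤ) → ∑ (tabulate g) f ≡ ∑[ i ← allFin n ] f (g i)
∑-tabulate {n = zero} g f = refl
∑-tabulate {n = suc n} g f =
  cong (_+_ (f (g zero))) (trans (∑-tabulate (λ i → g (suc i)) f) (sym (∑-tabulate suc (λ i → f (g i)))))

∑-allFin-suc : {l : ℕ} (f : Fin (suc l) → ℤ) → ∑ (allFin (suc l)) f ≡ f zero + ∑[ i ← allFin l ] f (suc i)
∑-allFin-suc f = cong (_+_ (f zero)) (∑-tabulate suc f)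

∑-upTo-suc : (m : ℕ) (f : ℕ → ℤ) → ∑ (upTo (suc m)) f ≡ f 0 + ∑[ k ← upTo m ] f (suc k)
∑-upTo-suc m f = cong (_+_ (f 0)) (∑-applyUpTo m suc f)
  where
  ∑-applyUpTo : (m : ℕ) (g : ℕ → ℕ) (f : ℕ → ℤ) → ∑ (applyUpTo g m) f ≡ ∑[ k ← upTo m ] f (g k)
  ∑-applyUpTo zero g f = refl
  ∑-applyUpTo (suc m) g f = cong (_+_ (f (g 0)))
    (trans (∑-applyUpTo m (λ k → g (suc k)) f) (sym (∑-applyUpTo m suc (λ k → f (g k)))))

∑-trunc : (N M : ℕ) (h : ℕ → ℤ) → M ≤ N → (∀ k → M ≤ k → h k ≡ 0ℤ) → ∑ (upTo N) h ≡ ∑ (upTo M) h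
∑-trunc zero zero h _ _ = refl
∑-trunc (suc N) zero h _ h≡0 =
  trans (∑-upTo-suc N h) (cong₂ _+_ (h≡0 0 z≤n) (∑-trunc N zero (λ k → h (suc k)) z≤n (λ k _ → h≡0 (suc k) z≤n)))
∑-trunc (suc N) (suc M) h (s≤s M≤N) h≡0 =
  trans (∑-upTo-suc N h)
        (trans (cong (_+_ (h 0)) (∑-trunc N M (λ k → h (suc k)) M≤N (λ k M≤k → h≡0 (suc k) (s≤s M≤k))))
               (sym (∑-upTo-suc M h)))

∑-allMaps-suc : (n l : ℕ) (f : Vec (Fin l) (suc n) → ℤ) →
  ∑ (allMaps (suc n) l) f ≡ ∑[ v ← allMaps n l ] ∑[ a ← allFin l ] f (a ∷ v)
∑-allMaps-suc n l f =
  trans (∑-concatMap _ (allMaps n l) f) (∑-cong (allMaps n l) (λ v → ∑-map (_∷ v) (allFin l) f))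

∑-allSubsets-suc : (n : ℕ) (f : Subset (suc n) → ℤ) →
  ∑ (allSubsets (suc n)) f ≡ ∑[ A ← allSubsets n ] (f (false ∷ A) + f (true ∷ A))
∑-allSubsets-suc n f = trans (∑-concatMap _ (allSubsets n) f)
  (∑-cong (allSubsets n) (λ A → cong (_+_ (f (false ∷ A))) (+-identityʳ _)))

∑-⟦∣∣≡ᵇ0⟧* : (n : ℕ) (f : Subset n → ℤ) → ∑[ A ← allSubsets n ] (⟦ ∣ A ∣ ≡ᵇ 0 ⟧ * f A) ≡ f ⊥
∑-⟦∣∣≡ᵇ0⟧* zero f = trans (+-identityʳ _) (*-identityˡ (f []))
∑-⟦∣∣≡ᵇ0⟧* (suc n) f = begin
    ∑[ A ← allSubsets (suc n) ] (⟦ ∣ A ∣ ≡ᵇ 0 ⟧ * f A)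
  ≡⟨ ∑-allSubsets-suc n (λ A → ⟦ ∣ A ∣ ≡ᵇ 0 ⟧ * f A) ⟩
    ∑[ A ← allSubsets n ] (⟦ ∣ A ∣ ≡ᵇ 0 ⟧ * f (false ∷ A) + 0ℤ * f (true ∷ A))
  ≡⟨ ∑-cong (allSubsets n) (λ A → trans (cong (_+_ (⟦ ∣ A ∣ ≡ᵇ 0 ⟧ * f (false ∷ A))) (*-zeroˡ (f (true ∷ A))))
                                        (+-identityʳ _)) ⟩
    ∑[ A ← allSubsets n ] (⟦ ∣ A ∣ ≡ᵇ 0 ⟧ * f (false ∷ A))
  ≡⟨ ∑-⟦∣∣≡ᵇ0⟧* n (λ A → f (false ∷ A)) ⟩
    f ⊥
  ∎
  where open ≡-Reasoning

+count≡∑ : {A : Set} (p : A → Bool) (xs : List A) → + count p xs ≡ ∑[ x ← xs ] ⟦ p x ⟧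
+count≡∑ p [] = refl
+count≡∑ p (x ∷ xs) with p x
... | true = cong (_+_ 1ℤ) (+count≡∑ p xs)
... | false = trans (+count≡∑ p xs) (sym (+-identityˡ _))

allᵇ-cong : {A : Set} (xs : List A) {p q : A → Bool} → (∀ x → p x ≡ q x) → allᵇ p xs ≡ allᵇ q xs
allᵇ-cong [] eq = refl
allᵇ-cong (x ∷ xs) eq = cong₂ _∧_ (eq x) (allᵇ-cong xs eq)

allᵇ-tabulate : {A : Set} {n : ℕ} (g : Fin n → A) (p : A → Bool) →
  allᵇ p (tabulate g) ≡ allᵇ (λ i → p (g i)) (allFin n)
allᵇ-tabulate {n = zero} g p = refl
allᵇ-tabulate {n = suc n} g p =
  cong (p (g zero) ∧_) (trans (allᵇ-tabulate (λ i → g (suc i)) p) (sym (allᵇ-tabulate suc (λ i → p (g i)))))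

allᵇ-allFin-suc : {l : ℕ} (p : Fin (suc l) → Bool) →
  allᵇ p (allFin (suc l)) ≡ p zero ∧ allᵇ (λ i → p (suc i)) (allFin l)
allᵇ-allFin-suc p = cong (p zero ∧_) (allᵇ-tabulate suc p)

allᵇ-intro : {A : Set} (xs : List A) {p : A → Bool} → (∀ x → p x ≡ true) → allᵇ p xs ≡ true
allᵇ-intro [] _ = refl
allᵇ-intro (x ∷ xs) holds rewrite holds x = allᵇ-intro xs holds

allᵇ-mono : {A : Set} (xs : List A) {p q : A → Bool} →
  (∀ x → p x ≡ true → q x ≡ true) → allᵇ p xs ≡ true → allᵇ q xs ≡ true
allᵇ-mono [] _ _ = refl
allᵇ-mono (x ∷ xs) {p} {q} p⇒q all-p with p x in px | q x in qx
... | true | true = allᵇ-mono xs p⇒q all-p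
... | true | false with () ← trans (sym (p⇒q x px)) qx

_⊆ᵇ_ : {n : ℕ} → Subset n → Subset n → Bool
[] ⊆ᵇ [] = true
(a ∷ A) ⊆ᵇ (u ∷ U) = (not a ∨ u) ∧ (A ⊆ᵇ U)

_∖_ : {n : ℕ} → Subset n → Subset n → Subset n
[] ∖ [] = []
(u ∷ U) ∖ (a ∷ A) = (u ∧ not a) ∷ (U ∖ A)

⌊⊆?⌋≡⊆ᵇ : {n : ℕ} (A U : Subset n) → ⌊ A ⊆? U ⌋ ≡ A ⊆ᵇ U
⌊⊆?⌋≡⊆ᵇ [] [] = refl
⌊⊆?⌋≡⊆ᵇ (true ∷ A) (false ∷ U) = refl
⌊⊆?⌋≡⊆ᵇ (true ∷ A) (true ∷ U) with A ⊆? U | ⌊⊆?⌋≡⊆ᵇ A U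
... | yes _ | eq = eq
... | no _ | eq = eq
⌊⊆?⌋≡⊆ᵇ (false ∷ A) (u ∷ U) with A ⊆? U | ⌊⊆?⌋≡⊆ᵇ A U
... | yes _ | eq = eq
... | no _ | eq = eq

⊆ᵇ-trans : {n : ℕ} (A K U : Subset n) → A ⊆ᵇ K ≡ true → K ⊆ᵇ U ≡ true → A ⊆ᵇ U ≡ true
⊆ᵇ-trans [] [] [] _ _ = refl
⊆ᵇ-trans (true ∷ A) (true ∷ K) (true ∷ U) A⊆K K⊆U = ⊆ᵇ-trans A K U A⊆K K⊆U
⊆ᵇ-trans (false ∷ A) (true ∷ K) (true ∷ U) A⊆K K⊆U = ⊆ᵇ-trans A K U A⊆K K⊆U
⊆ᵇ-trans (false ∷ A) (false ∷ K) (u ∷ U) A⊆K K⊆U = ⊆ᵇ-trans A K U A⊆K K⊆U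
⊆ᵇ-trans (true ∷ A) (false ∷ K) U () K⊆U
⊆ᵇ-trans (a ∷ A) (true ∷ K) (false ∷ U) A⊆K ()

⊥⊆ᵇ : {n : ℕ} (U : Subset n) → ⊥ ⊆ᵇ U ≡ true
⊥⊆ᵇ [] = refl
⊥⊆ᵇ (u ∷ U) = ⊥⊆ᵇ U

∖-⊆ᵇ : {n : ℕ} (U A : Subset n) → (U ∖ A) ⊆ᵇ U ≡ true
∖-⊆ᵇ [] [] = refl
∖-⊆ᵇ (true ∷ U) (true ∷ A) = ∖-⊆ᵇ U A
∖-⊆ᵇ (true ∷ U) (false ∷ A) = ∖-⊆ᵇ U A
∖-⊆ᵇ (false ∷ U) (a ∷ A) = ∖-⊆ᵇ U A

∖-⊥ : {n : ℕ} (U : Subset n) → U ∖ ⊥ ≡ U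
∖-⊥ [] = refl
∖-⊥ (u ∷ U) = cong₂ _∷_ (Boolₚ.∧-identityʳ u) (∖-⊥ U)

∖-∖ : {n : ℕ} (U A K : Subset n) → A ⊆ᵇ K ≡ true → (U ∖ A) ∖ (K ∖ A) ≡ U ∖ K
∖-∖ [] [] [] _ = refl
∖-∖ (u ∷ U) (true ∷ A) (true ∷ K) A⊆K = cong₂ _∷_ (Boolₚ.∧-identityʳ (u ∧ false)) (∖-∖ U A K A⊆K)
∖-∖ (u ∷ U) (false ∷ A) (true ∷ K) A⊆K =
  cong₂ _∷_ (trans (Boolₚ.∧-zeroʳ (u ∧ true)) (sym (Boolₚ.∧-zeroʳ u))) (∖-∖ U A K A⊆K)
∖-∖ (u ∷ U) (false ∷ A) (false ∷ K) A⊆K = cong₂ _∷_ (Boolₚ.∧-identityʳ (u ∧ true)) (∖-∖ U A K A⊆K)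
∖-∖ (u ∷ U) (true ∷ A) (false ∷ K) ()

∣∖∣+∣∣ : {n : ℕ} (A K : Subset n) → A ⊆ᵇ K ≡ true → ∣ K ∖ A ∣ ℕ.+ ∣ A ∣ ≡ ∣ K ∣
∣∖∣+∣∣ [] [] _ = refl
∣∖∣+∣∣ (true ∷ A) (true ∷ K) A⊆K = trans (ℕₚ.+-suc _ _) (cong suc (∣∖∣+∣∣ A K A⊆K))
∣∖∣+∣∣ (false ∷ A) (true ∷ K) A⊆K = cong suc (∣∖∣+∣∣ A K A⊆K)
∣∖∣+∣∣ (false ∷ A) (false ∷ K) A⊆K = ∣∖∣+∣∣ A K A⊆K
∣∖∣+∣∣ (true ∷ A) (false ∷ K) ()

∣∖∣<∣∣ : {n : ℕ} (A K : Subset n) → A ⊆ᵇ K ≡ true → 0 < ∣ A ∣ → ∣ K ∖ A ∣ < ∣ K ∣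
∣∖∣<∣∣ A K A⊆K 0<∣A∣ = subst (∣ K ∖ A ∣ <_) (∣∖∣+∣∣ A K A⊆K) (ℕₚ.m<m+n ∣ K ∖ A ∣ 0<∣A∣)

⊆ᵇ⊥⇒∣∣≡0 : {n : ℕ} (A : Subset n) → A ⊆ᵇ ⊥ ≡ true → ∣ A ∣ ≡ 0
⊆ᵇ⊥⇒∣∣≡0 [] _ = refl
⊆ᵇ⊥⇒∣∣≡0 (false ∷ A) A⊆⊥ = ⊆ᵇ⊥⇒∣∣≡0 A A⊆⊥

discreteᵇ-⊆ : {n : ℕ} (B : Subset n → Bool) (A J : Subset n) →
  discreteᵇ B J ≡ true → A ⊆ᵇ J ≡ true → discreteᵇ B A ≡ true
discreteᵇ-⊆ {n} B A J discrete-J A⊆J = allᵇ-mono (allSubsets n) clause discrete-J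
  where
  antitone : ∀ b {x y} m → (x ≡ true → y ≡ true) → (not (b ∧ y) ∨ m) ≡ true → (not (b ∧ x) ∨ m) ≡ true
  antitone false m _ _ = refl
  antitone true {false} m _ _ = refl
  antitone true {true} true _ _ = refl
  antitone true {true} {false} false x⇒y _ with () ← x⇒y refl
  clause : ∀ S → (not (B S ∧ ⌊ S ⊆? J ⌋) ∨ (∣ S ∣ ≤ᵇ 1)) ≡ true → (not (B S ∧ ⌊ S ⊆? A ⌋) ∨ (∣ S ∣ ≤ᵇ 1)) ≡ true
  clause S rewrite ⌊⊆?⌋≡⊆ᵇ S J | ⌊⊆?⌋≡⊆ᵇ S A =
    antitone (B S) (∣ S ∣ ≤ᵇ 1) (λ S⊆A → ⊆ᵇ-trans S A J S⊆A A⊆J)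

discreteᵇ-⊥ : {n : ℕ} (B : Subset n → Bool) → discreteᵇ B ⊥ ≡ true
discreteᵇ-⊥ {n} B = allᵇ-intro (allSubsets n) clause
  where
  clause : ∀ S → (not (B S ∧ ⌊ S ⊆? ⊥ ⌋) ∨ (∣ S ∣ ≤ᵇ 1)) ≡ true
  clause S rewrite ⌊⊆?⌋≡⊆ᵇ S ⊥ with B S | S ⊆ᵇ ⊥ in S⊆⊥
  ... | false | _ = refl
  ... | true | false = refl
  ... | true | true rewrite ⊆ᵇ⊥⇒∣∣≡0 S S⊆⊥ = refl

nonzero⇔ : {l : ℕ} → Fin (suc l) → Bool → Bool
nonzero⇔ zero u = not u
nonzero⇔ (suc _) u = u

support≡ᵇ : {n l : ℕ} → Vec (Fin (suc l)) n → Subset n → Bool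
support≡ᵇ [] [] = true
support≡ᵇ (a ∷ g) (u ∷ U) = nonzero⇔ a u ∧ support≡ᵇ g U

-- An ordered decomposition of U into l blocks is encoded, as in Nk, by a map g : X → Fin (1 + l)
-- with support U whose i-th block is g⁻¹(suc i).
#decomp : {n l : ℕ} → Subset n → (Fin l → Subset n → Bool) → ℤ
#decomp {n} {l} U ps =
  ∑[ g ← allMaps n (suc l) ] ⟦ support≡ᵇ g U ∧ allᵇ (λ i → ps i (block g (suc i))) (allFin l) ⟧

inFirstBlock : {l : ℕ} → Fin (suc (suc l)) → Bool
inFirstBlock a = if ⌊ a Fin.≟ suc zero ⌋ then inside else outside

forgetFirstBlock : {l : ℕ} → Fin (suc (suc l)) → Fin (suc l)
forgetFirstBlock zero = zero
forgetFirstBlock (suc zero) = zero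
forgetFirstBlock (suc (suc p)) = suc p

-- u ∧ not c is the head of (u ∷ U) ∖ (c ∷ A), the shape needed in ∑-peelFirstBlock.
∑-peelFirstBlock-coordinate : {n l : ℕ} (u : Bool) (W : Subset (suc n) → Vec (Fin (suc l)) (suc n) → ℤ)
  (A : Subset n) (g : Vec (Fin (suc l)) n) →
  ∑[ a ← allFin (suc (suc l)) ] (⟦ nonzero⇔ a u ⟧ * W (inFirstBlock a ∷ A) (forgetFirstBlock a ∷ g))
  ≡ ∑[ b ← allFin (suc l) ] (⟦ nonzero⇔ b (u ∧ not false) ⟧ * W (false ∷ A) (b ∷ g))
    + ⟦ u ⟧ * ∑[ b ← allFin (suc l) ] (⟦ nonzero⇔ b (u ∧ not true) ⟧ * W (true ∷ A) (b ∷ g))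
∑-peelFirstBlock-coordinate {l = l} true W A g = begin
    ∑[ a ← allFin (suc (suc l)) ] (⟦ nonzero⇔ a true ⟧ * W (inFirstBlock a ∷ A) (forgetFirstBlock a ∷ g))
  ≡⟨ ∑-allFin-suc (λ a → ⟦ nonzero⇔ a true ⟧ * W (inFirstBlock a ∷ A) (forgetFirstBlock a ∷ g)) ⟩
    0ℤ * W (false ∷ A) (zero ∷ g) + ∑[ a ← allFin (suc l) ] (1ℤ * W (inFirstBlock (suc a) ∷ A) (forgetFirstBlock (suc a) ∷ g))
  ≡⟨ cong (_+_ (0ℤ * W (false ∷ A) (zero ∷ g))) (∑-allFin-suc (λ a → 1ℤ * W (inFirstBlock (suc a) ∷ A) (forgetFirstBlock (suc a) ∷ g))) ⟩
    0ℤ * W (false ∷ A) (zero ∷ g) + (1ℤ * W (true ∷ A) (zero ∷ g) + s)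
  ≡⟨ rearrange (W (false ∷ A) (zero ∷ g)) (W (true ∷ A) (zero ∷ g)) s ⟩
    0ℤ * W (false ∷ A) (zero ∷ g) + s + 1ℤ * (1ℤ * W (true ∷ A) (zero ∷ g) + 0ℤ)
  ≡⟨ cong (λ z → 0ℤ * W (false ∷ A) (zero ∷ g) + s + 1ℤ * (1ℤ * W (true ∷ A) (zero ∷ g) + z))
          (sym (∑-zero (allFin l) (λ p → *-zeroˡ (W (true ∷ A) (suc p ∷ g))))) ⟩
    0ℤ * W (false ∷ A) (zero ∷ g) + s + 1ℤ * (1ℤ * W (true ∷ A) (zero ∷ g) + ∑[ p ← allFin l ] (0ℤ * W (true ∷ A) (suc p ∷ g)))
  ≡⟨ sym (cong₂ (λ x y → x + 1ℤ * y) 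
          (∑-allFin-suc (λ b → ⟦ nonzero⇔ b true ⟧ * W (false ∷ A) (b ∷ g)))
          (∑-allFin-suc (λ b → ⟦ nonzero⇔ b false ⟧ * W (true ∷ A) (b ∷ g)))) ⟩
    ∑[ b ← allFin (suc l) ] (⟦ nonzero⇔ b true ⟧ * W (false ∷ A) (b ∷ g))
      + 1ℤ * ∑[ b ← allFin (suc l) ] (⟦ nonzero⇔ b false ⟧ * W (true ∷ A) (b ∷ g))
  ∎
  where
  open ≡-Reasoning
  s : ℤ
  s = ∑[ p ← allFin l ] (1ℤ * W (false ∷ A) (suc p ∷ g))
  rearrange : ∀ x w s → 0ℤ * x + (1ℤ * w + s) ≡ 0ℤ * x + s + 1ℤ * (1ℤ * w + 0ℤ)
  rearrange = solve-∀
∑-peelFirstBlock-coordinate {l = l} false W A g = begin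
    ∑[ a ← allFin (suc (suc l)) ] (⟦ nonzero⇔ a false ⟧ * W (inFirstBlock a ∷ A) (forgetFirstBlock a ∷ g))
  ≡⟨ ∑-allFin-suc (λ a → ⟦ nonzero⇔ a false ⟧ * W (inFirstBlock a ∷ A) (forgetFirstBlock a ∷ g)) ⟩
    1ℤ * W (false ∷ A) (zero ∷ g) + ∑[ a ← allFin (suc l) ] (0ℤ * W (inFirstBlock (suc a) ∷ A) (forgetFirstBlock (suc a) ∷ g))
  ≡⟨ cong (_+_ (1ℤ * W (false ∷ A) (zero ∷ g)))
          (trans (∑-zero (allFin (suc l)) (λ _ → refl)) (sym (∑-zero (allFin l) (λ _ → refl)))) ⟩
    1ℤ * W (false ∷ A) (zero ∷ g) + ∑[ p ← allFin l ] (0ℤ * W (false ∷ A) (suc p ∷ g))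
  ≡⟨ sym (∑-allFin-suc (λ b → ⟦ nonzero⇔ b false ⟧ * W (false ∷ A) (b ∷ g))) ⟩
    ∑[ b ← allFin (suc l) ] (⟦ nonzero⇔ b false ⟧ * W (false ∷ A) (b ∷ g))
  ≡⟨ sym (+-identityʳ _) ⟩
    ∑[ b ← allFin (suc l) ] (⟦ nonzero⇔ b false ⟧ * W (false ∷ A) (b ∷ g)) + 0ℤ
  ∎
  where open ≡-Reasoning

-- A map into 2 + l blocks with support U is its first block A ⊆ U together with a map into
-- 1 + l blocks with support U ∖ A.
∑-peelFirstBlock : {l : ℕ} (n : ℕ) (U : Subset n) (W : Subset n → Vec (Fin (suc l)) n → ℤ) →
  ∑[ f ← allMaps n (suc (suc l)) ] (⟦ support≡ᵇ f U ⟧ * W (block f (suc zero)) (Vec.map forgetFirstBlock f))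
  ≡ ∑[ A ← allSubsets n ] (⟦ A ⊆ᵇ U ⟧ * ∑[ g ← allMaps n (suc l) ] (⟦ support≡ᵇ g (U ∖ A) ⟧ * W A g))
∑-peelFirstBlock zero [] W = lemma (W [] [])
  where
  lemma : ∀ x → 1ℤ * x + 0ℤ ≡ 1ℤ * (1ℤ * x + 0ℤ) + 0ℤ
  lemma = solve-∀
∑-peelFirstBlock {l} (suc n) (u ∷ U) W = begin
    ∑[ f ← allMaps (suc n) (suc (suc l)) ] (⟦ support≡ᵇ f (u ∷ U) ⟧ * W (block f (suc zero)) (Vec.map forgetFirstBlock f))
  ≡⟨ ∑-allMaps-suc n _ _ ⟩
    ∑[ f ← allMaps n (suc (suc l)) ] ∑[ a ← allFin (suc (suc l)) ]
      (⟦ nonzero⇔ a u ∧ support≡ᵇ f U ⟧ * W (inFirstBlock a ∷ block f (suc zero)) (forgetFirstBlock a ∷ Vec.map forgetFirstBlock f))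
  ≡⟨ ∑-cong (allMaps n (suc (suc l))) (λ f →
       trans (∑-cong (allFin (suc (suc l))) (λ a → ⟦∧⟧*-swap (nonzero⇔ a u) (support≡ᵇ f U) _))
             (∑-*ˡ ⟦ support≡ᵇ f U ⟧ (allFin (suc (suc l))) _)) ⟩
    ∑[ f ← allMaps n (suc (suc l)) ] (⟦ support≡ᵇ f U ⟧ * W′ (block f (suc zero)) (Vec.map forgetFirstBlock f))
  ≡⟨ ∑-peelFirstBlock n U W′ ⟩
    ∑[ A ← allSubsets n ] (⟦ A ⊆ᵇ U ⟧ * ∑[ g ← allMaps n (suc l) ] (⟦ support≡ᵇ g (U ∖ A) ⟧ * W′ A g))
  ≡⟨ ∑-cong (allSubsets n) split ⟩
    ∑[ A ← allSubsets n ] (peeled (false ∷ A) + peeled (true ∷ A))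
  ≡⟨ sym (∑-allSubsets-suc n peeled) ⟩
    ∑[ A ← allSubsets (suc n) ] peeled A
  ∎
  where
  open ≡-Reasoning
  peeled : Subset (suc n) → ℤ
  peeled A = ⟦ A ⊆ᵇ (u ∷ U) ⟧ * ∑[ g ← allMaps (suc n) (suc l) ] (⟦ support≡ᵇ g ((u ∷ U) ∖ A) ⟧ * W A g)
  W′ : Subset n → Vec (Fin (suc l)) n → ℤ
  W′ A g = ∑[ a ← allFin (suc (suc l)) ] (⟦ nonzero⇔ a u ⟧ * W (inFirstBlock a ∷ A) (forgetFirstBlock a ∷ g))
  W″ : Bool → Subset n → Vec (Fin (suc l)) n → ℤ
  W″ c A g = ∑[ b ← allFin (suc l) ] (⟦ nonzero⇔ b (u ∧ not c) ⟧ * W (c ∷ A) (b ∷ g))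
  ⟦∧⟧*-swap : ∀ x y w → ⟦ x ∧ y ⟧ * w ≡ ⟦ y ⟧ * (⟦ x ⟧ * w)
  ⟦∧⟧*-swap x y w = trans (cong (_* w) (⟦∧⟧ x y)) (swap ⟦ x ⟧ ⟦ y ⟧ w)
    where
    swap : ∀ a b c → a * b * c ≡ b * (a * c)
    swap = solve-∀
  peel-coordinate : (c : Bool) (A : Subset n) →
    ∑[ g ← allMaps (suc n) (suc l) ] (⟦ support≡ᵇ g ((u ∷ U) ∖ (c ∷ A)) ⟧ * W (c ∷ A) g)
    ≡ ∑[ g ← allMaps n (suc l) ] (⟦ support≡ᵇ g (U ∖ A) ⟧ * W″ c A g)
  peel-coordinate c A = trans (∑-allMaps-suc n (suc l) _) (∑-cong (allMaps n (suc l)) (λ g →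
    trans (∑-cong (allFin (suc l)) (λ b → ⟦∧⟧*-swap (nonzero⇔ b (u ∧ not c)) (support≡ᵇ g (U ∖ A)) _))
          (∑-*ˡ ⟦ support≡ᵇ g (U ∖ A) ⟧ (allFin (suc l)) _)))
  split : (A : Subset n) →
    ⟦ A ⊆ᵇ U ⟧ * ∑[ g ← allMaps n (suc l) ] (⟦ support≡ᵇ g (U ∖ A) ⟧ * W′ A g) ≡ peeled (false ∷ A) + peeled (true ∷ A)
  split A = begin
      ⟦ A ⊆ᵇ U ⟧ * ∑[ g ← allMaps n (suc l) ] (⟦ support≡ᵇ g (U ∖ A) ⟧ * W′ A g)
    ≡⟨ cong (⟦ A ⊆ᵇ U ⟧ *_) (∑-cong (allMaps n (suc l)) (λ g →
         trans (cong (⟦ support≡ᵇ g (U ∖ A) ⟧ *_) (∑-peelFirstBlock-coordinate u W A g))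
               (distrib ⟦ support≡ᵇ g (U ∖ A) ⟧ (W″ false A g) ⟦ u ⟧ (W″ true A g)))) ⟩
      ⟦ A ⊆ᵇ U ⟧ * ∑[ g ← allMaps n (suc l) ] (Σ₀ g + ⟦ u ⟧ * Σ₁ g)
    ≡⟨ cong (⟦ A ⊆ᵇ U ⟧ *_) (trans (∑-+ (allMaps n (suc l)) Σ₀ (λ g → ⟦ u ⟧ * Σ₁ g))
                                    (cong (_+_ (∑ (allMaps n (suc l)) Σ₀)) (∑-*ˡ ⟦ u ⟧ (allMaps n (suc l)) Σ₁))) ⟩
      ⟦ A ⊆ᵇ U ⟧ * (∑ (allMaps n (suc l)) Σ₀ + ⟦ u ⟧ * ∑ (allMaps n (suc l)) Σ₁)
    ≡⟨ distrib ⟦ A ⊆ᵇ U ⟧ _ ⟦ u ⟧ _ ⟩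
      ⟦ A ⊆ᵇ U ⟧ * ∑ (allMaps n (suc l)) Σ₀ + ⟦ u ⟧ * (⟦ A ⊆ᵇ U ⟧ * ∑ (allMaps n (suc l)) Σ₁)
    ≡⟨ cong₂ _+_ (cong (⟦ A ⊆ᵇ U ⟧ *_) (sym (peel-coordinate false A)))
                 (trans (sym (*-assoc ⟦ u ⟧ ⟦ A ⊆ᵇ U ⟧ _))
                        (cong₂ _*_ (sym (⟦∧⟧ u (A ⊆ᵇ U))) (sym (peel-coordinate true A)))) ⟩
      peeled (false ∷ A) + peeled (true ∷ A)
    ∎
    where
    Σ₀ Σ₁ : Vec (Fin (suc l)) n → ℤ
    Σ₀ g = ⟦ support≡ᵇ g (U ∖ A) ⟧ * W″ false A g
    Σ₁ g = ⟦ support≡ᵇ g (U ∖ A) ⟧ * W″ true A g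
    distrib : ∀ z a i b → z * (a + i * b) ≡ z * a + i * (z * b)
    distrib = solve-∀

⌊suc≟suc⌋ : {l : ℕ} (a i : Fin l) → ⌊ suc a Fin.≟ suc i ⌋ ≡ ⌊ a Fin.≟ i ⌋
⌊suc≟suc⌋ a i = ⌊⌋-map′ (cong suc) Finₚ.suc-injective (a Fin.≟ i)

block-forgetFirstBlock : {n l : ℕ} (f : Vec (Fin (suc (suc l))) n) (i : Fin l) →
  block f (suc (suc i)) ≡ block (Vec.map forgetFirstBlock f) (suc i)
block-forgetFirstBlock [] i = refl
block-forgetFirstBlock (zero ∷ f) i = cong (outside ∷_) (block-forgetFirstBlock f i)
block-forgetFirstBlock (suc zero ∷ f) i = cong (outside ∷_) (block-forgetFirstBlock f i)
block-forgetFirstBlock (suc (suc p) ∷ f) i =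
  cong₂ _∷_ (cong (if_then inside else outside) (⌊suc≟suc⌋ (suc p) (suc i))) (block-forgetFirstBlock f i)

block-map-suc : {n l : ℕ} (f : Vec (Fin l) n) (i : Fin l) → block (Vec.map suc f) (suc i) ≡ block f i
block-map-suc [] i = refl
block-map-suc (a ∷ f) i = cong₂ _∷_ (cong (if_then inside else outside) (⌊suc≟suc⌋ a i)) (block-map-suc f i)

#decomp-zero : {n : ℕ} (U : Subset n) (ps : Fin 0 → Subset n → Bool) → #decomp U ps ≡ ⟦ ∣ U ∣ ≡ᵇ 0 ⟧
#decomp-zero [] ps = refl
#decomp-zero {suc n} (true ∷ U) ps = trans (∑-allMaps-suc n 1 _) (∑-zero (allMaps n 1) (λ _ → refl))
#decomp-zero {suc n} (false ∷ U) ps =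
  trans (∑-allMaps-suc n 1 _) (trans (∑-cong (allMaps n 1) (λ _ → +-identityʳ _)) (#decomp-zero U (λ ())))

#decomp-suc : {n l : ℕ} (U : Subset n) (ps : Fin (suc l) → Subset n → Bool) →
  #decomp U ps ≡ ∑[ A ← allSubsets n ] (⟦ A ⊆ᵇ U ∧ ps zero A ⟧ * #decomp (U ∖ A) (λ i → ps (suc i)))
#decomp-suc {n} {l} U ps = begin
    #decomp U ps
  ≡⟨ ∑-cong (allMaps n (suc (suc l))) (λ f → trans (cong (λ b → ⟦ support≡ᵇ f U ∧ b ⟧) (split-conditions f))
                                                   (⟦∧⟧ (support≡ᵇ f U) _)) ⟩
    ∑[ f ← allMaps n (suc (suc l)) ] (⟦ support≡ᵇ f U ⟧ * W (block f (suc zero)) (Vec.map forgetFirstBlock f))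
  ≡⟨ ∑-peelFirstBlock n U W ⟩
    ∑[ A ← allSubsets n ] (⟦ A ⊆ᵇ U ⟧ * ∑[ g ← allMaps n (suc l) ] (⟦ support≡ᵇ g (U ∖ A) ⟧ * W A g))
  ≡⟨ ∑-cong (allSubsets n) factor ⟩
    ∑[ A ← allSubsets n ] (⟦ A ⊆ᵇ U ∧ ps zero A ⟧ * #decomp (U ∖ A) (λ i → ps (suc i)))
  ∎
  where
  open ≡-Reasoning
  rest : Vec (Fin (suc l)) n → Bool
  rest g = allᵇ (λ i → ps (suc i) (block g (suc i))) (allFin l)
  W : Subset n → Vec (Fin (suc l)) n → ℤ
  W A g = ⟦ ps zero A ∧ rest g ⟧
  split-conditions : (f : Vec (Fin (suc (suc l))) n) →
    allᵇ (λ i → ps i (block f (suc i))) (allFin (suc l)) ≡ ps zero (block f (suc zero)) ∧ rest (Vec.map forgetFirstBlock f)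
  split-conditions f = trans (allᵇ-allFin-suc (λ i → ps i (block f (suc i))))
    (cong (ps zero (block f (suc zero)) ∧_) (allᵇ-cong (allFin l) (λ i → cong (ps (suc i)) (block-forgetFirstBlock f i))))
  factor : (A : Subset n) → ⟦ A ⊆ᵇ U ⟧ * ∑[ g ← allMaps n (suc l) ] (⟦ support≡ᵇ g (U ∖ A) ⟧ * W A g)
           ≡ ⟦ A ⊆ᵇ U ∧ ps zero A ⟧ * #decomp (U ∖ A) (λ i → ps (suc i))
  factor A = begin
      ⟦ A ⊆ᵇ U ⟧ * ∑[ g ← allMaps n (suc l) ] (⟦ support≡ᵇ g (U ∖ A) ⟧ * W A g)
    ≡⟨ cong (⟦ A ⊆ᵇ U ⟧ *_) (∑-cong (allMaps n (suc l)) (λ g →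
         trans (cong (⟦ support≡ᵇ g (U ∖ A) ⟧ *_) (⟦∧⟧ (ps zero A) (rest g)))
               (trans (swap ⟦ support≡ᵇ g (U ∖ A) ⟧ ⟦ ps zero A ⟧ ⟦ rest g ⟧)
                      (cong (⟦ ps zero A ⟧ *_) (sym (⟦∧⟧ (support≡ᵇ g (U ∖ A)) (rest g))))))) ⟩
      ⟦ A ⊆ᵇ U ⟧ * ∑[ g ← allMaps n (suc l) ] (⟦ ps zero A ⟧ * ⟦ support≡ᵇ g (U ∖ A) ∧ rest g ⟧)
    ≡⟨ cong (⟦ A ⊆ᵇ U ⟧ *_) (∑-*ˡ ⟦ ps zero A ⟧ (allMaps n (suc l)) _) ⟩
      ⟦ A ⊆ᵇ U ⟧ * (⟦ ps zero A ⟧ * #decomp (U ∖ A) (λ i → ps (suc i)))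
    ≡⟨ sym (trans (cong (_* #decomp (U ∖ A) (λ i → ps (suc i))) (⟦∧⟧ (A ⊆ᵇ U) (ps zero A))) (*-assoc ⟦ A ⊆ᵇ U ⟧ _ _)) ⟩
      ⟦ A ⊆ᵇ U ∧ ps zero A ⟧ * #decomp (U ∖ A) (λ i → ps (suc i))
    ∎
    where
    swap : ∀ a b c → a * (b * c) ≡ b * (a * c)
    swap = solve-∀

∑-allMaps-support⊤ : (n l : ℕ) (W : Vec (Fin (suc l)) n → ℤ) →
  ∑[ f ← allMaps n l ] W (Vec.map suc f) ≡ ∑[ g ← allMaps n (suc l) ] (⟦ support≡ᵇ g ⊤ ⟧ * W g)
∑-allMaps-support⊤ zero l W = cong (_+ 0ℤ) (sym (*-identityˡ (W [])))
∑-allMaps-support⊤ (suc n) l W = begin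
    ∑[ f ← allMaps (suc n) l ] W (Vec.map suc f)
  ≡⟨ ∑-allMaps-suc n l _ ⟩
    ∑[ f ← allMaps n l ] ∑[ a ← allFin l ] W (suc a ∷ Vec.map suc f)
  ≡⟨ ∑-allMaps-support⊤ n l (λ g → ∑[ a ← allFin l ] W (suc a ∷ g)) ⟩
    ∑[ g ← allMaps n (suc l) ] (⟦ support≡ᵇ g ⊤ ⟧ * ∑[ a ← allFin l ] W (suc a ∷ g))
  ≡⟨ ∑-cong (allMaps n (suc l)) (λ g → trans (sym (∑-*ˡ ⟦ support≡ᵇ g ⊤ ⟧ (allFin l) _))
                                             (sym (+-identityˡ _))) ⟩
    ∑[ g ← allMaps n (suc l) ] (0ℤ + ∑[ a ← allFin l ] (⟦ support≡ᵇ g ⊤ ⟧ * W (suc a ∷ g)))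
  ≡⟨ ∑-cong (allMaps n (suc l)) (λ g → cong (_+ ∑[ a ← allFin l ] (⟦ support≡ᵇ g ⊤ ⟧ * W (suc a ∷ g)))
                                             (sym (*-zeroˡ (W (zero ∷ g))))) ⟩
    ∑[ g ← allMaps n (suc l) ] (⟦ support≡ᵇ (zero ∷ g) ⊤ ⟧ * W (zero ∷ g) + ∑[ a ← allFin l ] (⟦ support≡ᵇ (suc a ∷ g) ⊤ ⟧ * W (suc a ∷ g)))
  ≡⟨ sym (trans (∑-allMaps-suc n (suc l) _)
                (∑-cong (allMaps n (suc l)) (λ g → ∑-allFin-suc (λ b → ⟦ support≡ᵇ (b ∷ g) ⊤ ⟧ * W (b ∷ g))))) ⟩
    ∑[ g ← allMaps (suc n) (suc l) ] (⟦ support≡ᵇ g ⊤ ⟧ * W g)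
  ∎
  where open ≡-Reasoning

zetaOn : {n : ℕ} → (Subset n → Bool) → Subset n → List ℕ → ℤ
zetaOn D U β = #decomp U (λ i J → (∣ J ∣ ≡ᵇ List.lookup β i) ∧ D J)

zetaOn-∷ : {n : ℕ} (D : Subset n → Bool) (U : Subset n) (b : ℕ) (β : List ℕ) →
  zetaOn D U (b ∷ β) ≡ ∑[ A ← allSubsets n ] (⟦ A ⊆ᵇ U ∧ ((∣ A ∣ ≡ᵇ b) ∧ D A) ⟧ * zetaOn D (U ∖ A) β)
zetaOn-∷ D U b β = #decomp-suc U (λ i J → (∣ J ∣ ≡ᵇ List.lookup (b ∷ β) i) ∧ D J)

+zeta≡zetaOn⊤ : {n : ℕ} (B : Subset n → Bool) (β : List ℕ) → + zeta B β ≡ zetaOn (discreteᵇ B) ⊤ β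
+zeta≡zetaOn⊤ {n} B β = begin
    + zeta B β
  ≡⟨ +count≡∑ _ (allMaps n (length β)) ⟩
    ∑[ f ← allMaps n (length β) ] ⟦ allᵇ (λ i → ps i (block f i)) (allFin (length β)) ⟧
  ≡⟨ ∑-cong (allMaps n (length β)) (λ f →
       cong ⟦_⟧ (allᵇ-cong (allFin (length β)) (λ i → cong (ps i) (sym (block-map-suc f i))))) ⟩
    ∑[ f ← allMaps n (length β) ] W (Vec.map suc f)
  ≡⟨ ∑-allMaps-support⊤ n (length β) W ⟩
    ∑[ g ← allMaps n (suc (length β)) ] (⟦ support≡ᵇ g ⊤ ⟧ * W g)
  ≡⟨ ∑-cong (allMaps n (suc (length β))) (λ g → sym (⟦∧⟧ (support≡ᵇ g ⊤) _)) ⟩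
    zetaOn (discreteᵇ B) ⊤ β
  ∎
  where
  open ≡-Reasoning
  ps : Fin (length β) → Subset n → Bool
  ps i J = (∣ J ∣ ≡ᵇ List.lookup β i) ∧ discreteᵇ B J
  W : Vec (Fin (suc (length β))) n → ℤ
  W g = ⟦ allᵇ (λ i → ps i (block g (suc i))) (allFin (length β)) ⟧

-- A part of size 0 can only be the empty block, which D ⊥ admits exactly once.
zetaOn-filter-positive : {n : ℕ} (D : Subset n → Bool) → D ⊥ ≡ true → (U : Subset n) (β : List ℕ) →
  zetaOn D U (List.filter (ℕ._>? 0) β) ≡ zetaOn D U β
zetaOn-filter-positive D D⊥ U [] = refl
zetaOn-filter-positive D D⊥ U (suc b ∷ β) =
  trans (zetaOn-∷ D U (suc b) (List.filter (ℕ._>? 0) β))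
        (trans (∑-cong (allSubsets _) (λ A → cong (⟦ A ⊆ᵇ U ∧ ((∣ A ∣ ≡ᵇ suc b) ∧ D A) ⟧ *_)
                                                  (zetaOn-filter-positive D D⊥ (U ∖ A) β)))
               (sym (zetaOn-∷ D U (suc b) β)))
zetaOn-filter-positive {n} D D⊥ U (zero ∷ β) = sym (begin
    zetaOn D U (0 ∷ β)
  ≡⟨ zetaOn-∷ D U 0 β ⟩
    ∑[ A ← allSubsets n ] (⟦ A ⊆ᵇ U ∧ ((∣ A ∣ ≡ᵇ 0) ∧ D A) ⟧ * zetaOn D (U ∖ A) β)
  ≡⟨ ∑-cong (allSubsets n) (λ A → trans (cong (_* zetaOn D (U ∖ A) β) (⟦∧∧⟧ (A ⊆ᵇ U) (∣ A ∣ ≡ᵇ 0) (D A)))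
                                        (*-assoc ⟦ ∣ A ∣ ≡ᵇ 0 ⟧ _ _)) ⟩
    ∑[ A ← allSubsets n ] (⟦ ∣ A ∣ ≡ᵇ 0 ⟧ * (⟦ A ⊆ᵇ U ∧ D A ⟧ * zetaOn D (U ∖ A) β))
  ≡⟨ ∑-⟦∣∣≡ᵇ0⟧* n (λ A → ⟦ A ⊆ᵇ U ∧ D A ⟧ * zetaOn D (U ∖ A) β) ⟩
    ⟦ ⊥ ⊆ᵇ U ∧ D ⊥ ⟧ * zetaOn D (U ∖ ⊥) β
  ≡⟨ cong₂ (λ b V → ⟦ b ⟧ * zetaOn D V β) (trans (cong (_∧ D ⊥) (⊥⊆ᵇ U)) D⊥) (∖-⊥ U) ⟩
    1ℤ * zetaOn D U β
  ≡⟨ *-identityˡ _ ⟩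
    zetaOn D U β
  ≡⟨ sym (zetaOn-filter-positive D D⊥ U β) ⟩
    zetaOn D U (List.filter (ℕ._>? 0) β)
  ∎)
  where
  open ≡-Reasoning
  ⟦∧∧⟧ : ∀ s c d → ⟦ s ∧ (c ∧ d) ⟧ ≡ ⟦ c ⟧ * ⟦ s ∧ d ⟧
  ⟦∧∧⟧ s true d = sym (*-identityˡ ⟦ s ∧ d ⟧)
  ⟦∧∧⟧ true false d = refl
  ⟦∧∧⟧ false false d = refl

-- Pairs of disjoint subsets, regrouped by their union

∑𝔹 : (Bool → ℤ) → ℤ
∑𝔹 h = h false + h true

∑𝔹-*ˡ : (c : ℤ) (h : Bool → ℤ) → ∑𝔹 (λ b → c * h b) ≡ c * ∑𝔹 h
∑𝔹-*ˡ c h = sym (*-distribˡ-+ c (h false) (h true))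

∑𝔹-∑ : {A : Set} (xs : List A) (h : A → Bool → ℤ) → ∑𝔹 (λ b → ∑[ x ← xs ] h x b) ≡ ∑[ x ← xs ] ∑𝔹 (h x)
∑𝔹-∑ xs h = sym (∑-+ xs (λ x → h x false) (λ x → h x true))

∑-disjointPairs : {n : ℕ} → Subset n → (Subset n → Subset n → ℤ) → ℤ
∑-disjointPairs {n} U F =
  ∑[ A ← allSubsets n ] ∑[ A′ ← allSubsets n ] (⟦ A ⊆ᵇ U ∧ A′ ⊆ᵇ (U ∖ A) ⟧ * F A A′)

∑-splits : {n : ℕ} → Subset n → (Subset n → Subset n → ℤ) → ℤ
∑-splits {n} U F = ∑[ K ← allSubsets n ] (⟦ K ⊆ᵇ U ⟧ * ∑[ A ← allSubsets n ] (⟦ A ⊆ᵇ K ⟧ * F A (K ∖ A)))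

∑-disjointPairs-∷ : {n : ℕ} (u : Bool) (U : Subset n) (F : Subset (suc n) → Subset (suc n) → ℤ) →
  ∑-disjointPairs (u ∷ U) F
  ≡ ∑-disjointPairs U (λ A A′ → ∑𝔹 (λ c → ∑𝔹 (λ c′ → ⟦ (not c ∨ u) ∧ (not c′ ∨ (u ∧ not c)) ⟧ * F (c ∷ A) (c′ ∷ A′))))
∑-disjointPairs-∷ {n} u U F = begin
    ∑-disjointPairs (u ∷ U) F
  ≡⟨ ∑-allSubsets-suc n _ ⟩
    ∑[ A ← allSubsets n ] ∑𝔹 (λ c → ∑[ A′ ← allSubsets (suc n) ] (⟦ (c ∷ A) ⊆ᵇ (u ∷ U) ∧ A′ ⊆ᵇ ((u ∷ U) ∖ (c ∷ A)) ⟧ * F (c ∷ A) A′))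
  ≡⟨ ∑-cong (allSubsets n) (λ A → cong₂ _+_ (∑-allSubsets-suc n _) (∑-allSubsets-suc n _)) ⟩
    ∑[ A ← allSubsets n ] ∑𝔹 (λ c → ∑[ A′ ← allSubsets n ] ∑𝔹 (λ c′ → ⟦ guard c c′ A A′ ⟧ * F (c ∷ A) (c′ ∷ A′)))
  ≡⟨ ∑-cong (allSubsets n) (λ A → ∑𝔹-∑ (allSubsets n) (λ A′ c → ∑𝔹 (λ c′ → ⟦ guard c c′ A A′ ⟧ * F (c ∷ A) (c′ ∷ A′)))) ⟩
    ∑[ A ← allSubsets n ] ∑[ A′ ← allSubsets n ] ∑𝔹 (λ c → ∑𝔹 (λ c′ → ⟦ guard c c′ A A′ ⟧ * F (c ∷ A) (c′ ∷ A′)))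
  ≡⟨ ∑-cong (allSubsets n) (λ A → ∑-cong (allSubsets n) (λ A′ → factor A A′)) ⟩
    ∑-disjointPairs U (λ A A′ → ∑𝔹 (λ c → ∑𝔹 (λ c′ → ⟦ local c c′ ⟧ * F (c ∷ A) (c′ ∷ A′))))
  ∎
  where
  open ≡-Reasoning
  local : Bool → Bool → Bool
  local c c′ = (not c ∨ u) ∧ (not c′ ∨ (u ∧ not c))
  guard : Bool → Bool → Subset n → Subset n → Bool
  guard c c′ A A′ = ((not c ∨ u) ∧ (A ⊆ᵇ U)) ∧ ((not c′ ∨ (u ∧ not c)) ∧ (A′ ⊆ᵇ (U ∖ A)))
  ⟦∧⟧-interchange : ∀ p s q t → ⟦ (p ∧ s) ∧ (q ∧ t) ⟧ ≡ ⟦ s ∧ t ⟧ * ⟦ p ∧ q ⟧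
  ⟦∧⟧-interchange true true true t = sym (*-identityʳ ⟦ t ⟧)
  ⟦∧⟧-interchange true true false t = sym (*-zeroʳ ⟦ t ⟧)
  ⟦∧⟧-interchange true false q t = sym (*-zeroˡ ⟦ q ∧ t ⟧)
  ⟦∧⟧-interchange false s q t = sym (*-zeroʳ ⟦ s ∧ t ⟧)
  factor : (A A′ : Subset n) →
    ∑𝔹 (λ c → ∑𝔹 (λ c′ → ⟦ guard c c′ A A′ ⟧ * F (c ∷ A) (c′ ∷ A′)))
    ≡ ⟦ A ⊆ᵇ U ∧ A′ ⊆ᵇ (U ∖ A) ⟧ * ∑𝔹 (λ c → ∑𝔹 (λ c′ → ⟦ local c c′ ⟧ * F (c ∷ A) (c′ ∷ A′)))
  factor A A′ = begin
      ∑𝔹 (λ c → ∑𝔹 (λ c′ → ⟦ guard c c′ A A′ ⟧ * F (c ∷ A) (c′ ∷ A′)))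
    ≡⟨ cong₂ _+_ (cong₂ _+_ (pull false false) (pull false true)) (cong₂ _+_ (pull true false) (pull true true)) ⟩
      ∑𝔹 (λ c → ∑𝔹 (λ c′ → k * (⟦ local c c′ ⟧ * F (c ∷ A) (c′ ∷ A′))))
    ≡⟨ cong₂ _+_ (∑𝔹-*ˡ k (λ c′ → ⟦ local false c′ ⟧ * F (false ∷ A) (c′ ∷ A′)))
                 (∑𝔹-*ˡ k (λ c′ → ⟦ local true c′ ⟧ * F (true ∷ A) (c′ ∷ A′))) ⟩
      ∑𝔹 (λ c → k * ∑𝔹 (λ c′ → ⟦ local c c′ ⟧ * F (c ∷ A) (c′ ∷ A′)))
    ≡⟨ ∑𝔹-*ˡ k (λ c → ∑𝔹 (λ c′ → ⟦ local c c′ ⟧ * F (c ∷ A) (c′ ∷ A′))) ⟩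
      k * ∑𝔹 (λ c → ∑𝔹 (λ c′ → ⟦ local c c′ ⟧ * F (c ∷ A) (c′ ∷ A′)))
    ∎
    where
    k : ℤ
    k = ⟦ A ⊆ᵇ U ∧ A′ ⊆ᵇ (U ∖ A) ⟧
    pull : ∀ c c′ → ⟦ guard c c′ A A′ ⟧ * F (c ∷ A) (c′ ∷ A′) ≡ k * (⟦ local c c′ ⟧ * F (c ∷ A) (c′ ∷ A′))
    pull c c′ = trans (cong (_* F (c ∷ A) (c′ ∷ A′)) (⟦∧⟧-interchange (not c ∨ u) (A ⊆ᵇ U) (not c′ ∨ (u ∧ not c)) (A′ ⊆ᵇ (U ∖ A))))
                      (*-assoc k ⟦ local c c′ ⟧ (F (c ∷ A) (c′ ∷ A′)))

∑-splits-∷ : {n : ℕ} (u : Bool) (U : Subset n) (F : Subset (suc n) → Subset (suc n) → ℤ) →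
  ∑-splits (u ∷ U) F
  ≡ ∑-splits U (λ A D → ∑𝔹 (λ k → ⟦ not k ∨ u ⟧ * ∑𝔹 (λ c → ⟦ not c ∨ k ⟧ * F (c ∷ A) ((k ∧ not c) ∷ D))))
∑-splits-∷ {n} u U F = begin
    ∑-splits (u ∷ U) F
  ≡⟨ ∑-allSubsets-suc n _ ⟩
    ∑[ K ← allSubsets n ] ∑𝔹 (λ k → ⟦ (not k ∨ u) ∧ (K ⊆ᵇ U) ⟧
                                      * ∑[ A ← allSubsets (suc n) ] (⟦ A ⊆ᵇ (k ∷ K) ⟧ * F A ((k ∷ K) ∖ A)))
  ≡⟨ ∑-cong (allSubsets n) (λ K → cong₂ _+_ (cong (⟦ K ⊆ᵇ U ⟧ *_) (∑-allSubsets-suc n _))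
                                            (cong (⟦ u ∧ (K ⊆ᵇ U) ⟧ *_) (∑-allSubsets-suc n _))) ⟩
    ∑[ K ← allSubsets n ] ∑𝔹 (λ k → ⟦ (not k ∨ u) ∧ (K ⊆ᵇ U) ⟧ * ∑[ A ← allSubsets n ] ∑𝔹 (λ c → H K k A c))
  ≡⟨ ∑-cong (allSubsets n) factor ⟩
    ∑-splits U (λ A D → ∑𝔹 (λ k → ⟦ not k ∨ u ⟧ * ∑𝔹 (λ c → ⟦ not c ∨ k ⟧ * F (c ∷ A) ((k ∧ not c) ∷ D))))
  ∎
  where
  open ≡-Reasoning
  H : Subset n → Bool → Subset n → Bool → ℤ
  H K k A c = ⟦ (not c ∨ k) ∧ (A ⊆ᵇ K) ⟧ * F (c ∷ A) ((k ∧ not c) ∷ (K ∖ A))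
  G : Subset n → Bool → Subset n → Bool → ℤ
  G K k A c = ⟦ not c ∨ k ⟧ * F (c ∷ A) ((k ∧ not c) ∷ (K ∖ A))
  swap : ∀ p q w → p * q * w ≡ q * (p * w)
  swap = solve-∀
  exchange : ∀ p q w → p * (q * w) ≡ q * (p * w)
  exchange = solve-∀
  pull-k : ∀ K k → ⟦ (not k ∨ u) ∧ (K ⊆ᵇ U) ⟧ * ∑[ A ← allSubsets n ] ∑𝔹 (H K k A)
    ≡ ⟦ K ⊆ᵇ U ⟧ * ∑[ A ← allSubsets n ] (⟦ A ⊆ᵇ K ⟧ * (⟦ not k ∨ u ⟧ * ∑𝔹 (G K k A)))
  pull-k K k = begin
      ⟦ (not k ∨ u) ∧ (K ⊆ᵇ U) ⟧ * ∑[ A ← allSubsets n ] ∑𝔹 (H K k A)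
    ≡⟨ cong₂ _*_ (⟦∧⟧ (not k ∨ u) (K ⊆ᵇ U))
                 (∑-cong (allSubsets n) (λ A → trans (cong₂ _+_ (pull-c A false) (pull-c A true)) (∑𝔹-*ˡ ⟦ A ⊆ᵇ K ⟧ (G K k A)))) ⟩
      ⟦ not k ∨ u ⟧ * ⟦ K ⊆ᵇ U ⟧ * ∑[ A ← allSubsets n ] (⟦ A ⊆ᵇ K ⟧ * ∑𝔹 (G K k A))
    ≡⟨ swap ⟦ not k ∨ u ⟧ ⟦ K ⊆ᵇ U ⟧ _ ⟩
      ⟦ K ⊆ᵇ U ⟧ * (⟦ not k ∨ u ⟧ * ∑[ A ← allSubsets n ] (⟦ A ⊆ᵇ K ⟧ * ∑𝔹 (G K k A)))
    ≡⟨ cong (⟦ K ⊆ᵇ U ⟧ *_) (trans (sym (∑-*ˡ ⟦ not k ∨ u ⟧ (allSubsets n) _))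
                                   (∑-cong (allSubsets n) (λ A → exchange ⟦ not k ∨ u ⟧ ⟦ A ⊆ᵇ K ⟧ (∑𝔹 (G K k A))))) ⟩
      ⟦ K ⊆ᵇ U ⟧ * ∑[ A ← allSubsets n ] (⟦ A ⊆ᵇ K ⟧ * (⟦ not k ∨ u ⟧ * ∑𝔹 (G K k A)))
    ∎
    where
    pull-c : ∀ A c → H K k A c ≡ ⟦ A ⊆ᵇ K ⟧ * G K k A c
    pull-c A c = trans (cong (_* F (c ∷ A) ((k ∧ not c) ∷ (K ∖ A))) (⟦∧⟧ (not c ∨ k) (A ⊆ᵇ K)))
                       (swap ⟦ not c ∨ k ⟧ ⟦ A ⊆ᵇ K ⟧ _)
  factor : (K : Subset n) →
    ∑𝔹 (λ k → ⟦ (not k ∨ u) ∧ (K ⊆ᵇ U) ⟧ * ∑[ A ← allSubsets n ] ∑𝔹 (H K k A))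
    ≡ ⟦ K ⊆ᵇ U ⟧ * ∑[ A ← allSubsets n ] (⟦ A ⊆ᵇ K ⟧ * ∑𝔹 (λ k → ⟦ not k ∨ u ⟧ * ∑𝔹 (λ c → ⟦ not c ∨ k ⟧ * F (c ∷ A) ((k ∧ not c) ∷ (K ∖ A)))))
  factor K = begin
      ∑𝔹 (λ k → ⟦ (not k ∨ u) ∧ (K ⊆ᵇ U) ⟧ * ∑[ A ← allSubsets n ] ∑𝔹 (H K k A))
    ≡⟨ cong₂ _+_ (pull-k K false) (pull-k K true) ⟩
      ∑𝔹 (λ k → ⟦ K ⊆ᵇ U ⟧ * ∑[ A ← allSubsets n ] (⟦ A ⊆ᵇ K ⟧ * (⟦ not k ∨ u ⟧ * ∑𝔹 (G K k A))))
    ≡⟨ ∑𝔹-*ˡ ⟦ K ⊆ᵇ U ⟧ (λ k → ∑[ A ← allSubsets n ] (⟦ A ⊆ᵇ K ⟧ * (⟦ not k ∨ u ⟧ * ∑𝔹 (G K k A)))) ⟩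
      ⟦ K ⊆ᵇ U ⟧ * ∑𝔹 (λ k → ∑[ A ← allSubsets n ] (⟦ A ⊆ᵇ K ⟧ * (⟦ not k ∨ u ⟧ * ∑𝔹 (G K k A))))
    ≡⟨ cong (⟦ K ⊆ᵇ U ⟧ *_) (∑𝔹-∑ (allSubsets n) (λ A k → ⟦ A ⊆ᵇ K ⟧ * (⟦ not k ∨ u ⟧ * ∑𝔹 (G K k A)))) ⟩
      ⟦ K ⊆ᵇ U ⟧ * ∑[ A ← allSubsets n ] ∑𝔹 (λ k → ⟦ A ⊆ᵇ K ⟧ * (⟦ not k ∨ u ⟧ * ∑𝔹 (G K k A)))
    ≡⟨ cong (⟦ K ⊆ᵇ U ⟧ *_) (∑-cong (allSubsets n) (λ A → ∑𝔹-*ˡ ⟦ A ⊆ᵇ K ⟧ (λ k → ⟦ not k ∨ u ⟧ * ∑𝔹 (G K k A)))) ⟩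
      ⟦ K ⊆ᵇ U ⟧ * ∑[ A ← allSubsets n ] (⟦ A ⊆ᵇ K ⟧ * ∑𝔹 (λ k → ⟦ not k ∨ u ⟧ * ∑𝔹 (G K k A)))
    ∎

∑-disjointPairs≡∑-splits : {n : ℕ} (U : Subset n) (F : Subset n → Subset n → ℤ) →
  ∑-disjointPairs U F ≡ ∑-splits U F
∑-disjointPairs≡∑-splits [] F = lemma (F [] [])
  where
  lemma : ∀ x → 1ℤ * x + 0ℤ + 0ℤ ≡ 1ℤ * (1ℤ * x + 0ℤ) + 0ℤ
  lemma = solve-∀
∑-disjointPairs≡∑-splits {suc n} (u ∷ U) F = begin
    ∑-disjointPairs (u ∷ U) F
  ≡⟨ ∑-disjointPairs-∷ u U F ⟩
    ∑-disjointPairs U (merged u)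
  ≡⟨ ∑-disjointPairs≡∑-splits U (merged u) ⟩
    ∑-splits U (merged u)
  ≡⟨ ∑-cong (allSubsets n) (λ K → cong (⟦ K ⊆ᵇ U ⟧ *_) (∑-cong (allSubsets n) (λ A →
       cong (⟦ A ⊆ᵇ K ⟧ *_) (coordinate u A (K ∖ A))))) ⟩
    ∑-splits U (split u)
  ≡⟨ sym (∑-splits-∷ u U F) ⟩
    ∑-splits (u ∷ U) F
  ∎
  where
  open ≡-Reasoning
  merged split : Bool → Subset n → Subset n → ℤ
  merged u A D = ∑𝔹 (λ c → ∑𝔹 (λ c′ → ⟦ (not c ∨ u) ∧ (not c′ ∨ (u ∧ not c)) ⟧ * F (c ∷ A) (c′ ∷ D)))
  split u A D = ∑𝔹 (λ k → ⟦ not k ∨ u ⟧ * ∑𝔹 (λ c → ⟦ not c ∨ k ⟧ * F (c ∷ A) ((k ∧ not c) ∷ D)))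
  coordinate : (u : Bool) (A D : Subset n) → merged u A D ≡ split u A D
  coordinate true A D = lemma (F (false ∷ A) (false ∷ D)) (F (false ∷ A) (true ∷ D)) (F (true ∷ A) (false ∷ D)) (F (true ∷ A) (true ∷ D))
    where
    lemma : ∀ a b c d → 1ℤ * a + 1ℤ * b + (1ℤ * c + 0ℤ * d) ≡ 1ℤ * (1ℤ * a + 0ℤ * c) + 1ℤ * (1ℤ * b + 1ℤ * c)
    lemma = solve-∀
  coordinate false A D = lemma (F (false ∷ A) (false ∷ D)) (F (false ∷ A) (true ∷ D)) (F (true ∷ A) (false ∷ D)) (F (true ∷ A) (true ∷ D))
    where
    lemma : ∀ a b c d → 1ℤ * a + 0ℤ * b + (0ℤ * c + 0ℤ * d) ≡ 1ℤ * (1ℤ * a + 0ℤ * c) + 0ℤ * (1ℤ * b + 1ℤ * c)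
    lemma = solve-∀

sign-+ : ∀ a b → sign (a ℕ.+ b) ≡ sign a * sign b
sign-+ zero b = sym (*-identityˡ (sign b))
sign-+ (suc a) b = trans (cong -_ (sign-+ a b)) (neg-distribˡ-* (sign a) (sign b))

sign-*-sign : ∀ k → sign k * sign k ≡ 1ℤ
sign-*-sign zero = refl
sign-*-sign (suc k) = trans (neg*neg (sign k)) (sign-*-sign k)
  where
  neg*neg : ∀ s → - s * - s ≡ s * s
  neg*neg = solve-∀

≡ᵇ-≡ : ∀ m n → (m ≡ᵇ n) ≡ true → m ≡ n
≡ᵇ-≡ m n eq = ℕₚ.≡ᵇ⇒≡ m n (subst T (sym eq) _)

≢ᵇ-< : ∀ m n → n < m → (m ≡ᵇ n) ≡ false
≢ᵇ-< m n n<m with m ≡ᵇ n in eq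
... | false = refl
... | true with () ← ℕₚ.<-irrefl (sym (≡ᵇ-≡ m n eq)) n<m

≡ᵇ-∸ : ∀ q p a → p ≤ a → (q ≡ᵇ a ∸ p) ≡ (q ℕ.+ p ≡ᵇ a)
≡ᵇ-∸ q zero a _ = cong (_≡ᵇ a) (sym (ℕₚ.+-identityʳ q))
≡ᵇ-∸ q (suc p) (suc a) (s≤s p≤a) = trans (≡ᵇ-∸ q p a p≤a) (cong (_≡ᵇ suc a) (sym (ℕₚ.+-suc q p)))

∑-⟦≡ᵇ⟧*-< : (N m : ℕ) (h : ℕ → ℤ) → m < N → ∑[ j ← upTo N ] (⟦ m ≡ᵇ j ⟧ * h j) ≡ h m
∑-⟦≡ᵇ⟧*-< (suc N) zero h _ = begin
    ∑[ j ← upTo (suc N) ] (⟦ 0 ≡ᵇ j ⟧ * h j)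
  ≡⟨ ∑-upTo-suc N (λ j → ⟦ 0 ≡ᵇ j ⟧ * h j) ⟩
    1ℤ * h 0 + ∑[ k ← upTo N ] (0ℤ * h (suc k))
  ≡⟨ cong (_+_ (1ℤ * h 0)) (∑-zero (upTo N) (λ k → *-zeroˡ (h (suc k)))) ⟩
    1ℤ * h 0 + 0ℤ
  ≡⟨ trans (+-identityʳ _) (*-identityˡ (h 0)) ⟩
    h 0
  ∎
  where open ≡-Reasoning
∑-⟦≡ᵇ⟧*-< (suc N) (suc m) h (s≤s m<N) =
  trans (∑-upTo-suc N (λ j → ⟦ suc m ≡ᵇ j ⟧ * h j))
        (trans (cong (_+ ∑[ k ← upTo N ] (⟦ m ≡ᵇ k ⟧ * h (suc k))) (*-zeroˡ (h 0)))
               (trans (+-identityˡ _) (∑-⟦≡ᵇ⟧*-< N m (λ k → h (suc k)) m<N)))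

∑-⟦≡ᵇ⟧*-≥ : (N m : ℕ) (h : ℕ → ℤ) → N ≤ m → ∑[ j ← upTo N ] (⟦ m ≡ᵇ j ⟧ * h j) ≡ 0ℤ
∑-⟦≡ᵇ⟧*-≥ zero m h _ = refl
∑-⟦≡ᵇ⟧*-≥ (suc N) (suc m) h (s≤s N≤m) =
  trans (∑-upTo-suc N (λ j → ⟦ suc m ≡ᵇ j ⟧ * h j))
        (trans (cong (_+ ∑[ k ← upTo N ] (⟦ m ≡ᵇ k ⟧ * h (suc k))) (*-zeroˡ (h 0)))
               (trans (+-identityˡ _) (∑-⟦≡ᵇ⟧*-≥ N m (λ k → h (suc k)) N≤m)))

∑-sizesOfTwoParts : (a p q : ℕ) (h : ℕ → ℤ) →
  ∑[ j ← upTo (suc a) ] (⟦ p ≡ᵇ j ⟧ * (⟦ q ≡ᵇ a ∸ j ⟧ * h j)) ≡ ⟦ q ℕ.+ p ≡ᵇ a ⟧ * h p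
∑-sizesOfTwoParts a p q h with p ℕ.≤? a
... | yes p≤a = trans (∑-⟦≡ᵇ⟧*-< (suc a) p (λ j → ⟦ q ≡ᵇ a ∸ j ⟧ * h j) (s≤s p≤a))
                      (cong (λ b → ⟦ b ⟧ * h p) (≡ᵇ-∸ q p a p≤a))
... | no p≰a = trans (∑-⟦≡ᵇ⟧*-≥ (suc a) p _ a<p)
                     (sym (trans (cong (λ b → ⟦ b ⟧ * h p) (≢ᵇ-< (q ℕ.+ p) a (ℕₚ.<-≤-trans a<p (ℕₚ.m≤n+m p q))))
                                 (*-zeroˡ (h p))))
  where
  a<p : a < p
  a<p = ℕₚ.≰⇒> p≰a

∑-*ˡ-disjointPairs : {n : ℕ} {J : Set} (js : List J) (c : J → ℤ) (U : Subset n) (F : J → Subset n → Subset n → ℤ) →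
  ∑[ j ← js ] (c j * ∑-disjointPairs U (F j)) ≡ ∑-disjointPairs U (λ A A′ → ∑[ j ← js ] (c j * F j A A′))
∑-*ˡ-disjointPairs {n} js c U F = begin
    ∑[ j ← js ] (c j * ∑-disjointPairs U (F j))
  ≡⟨ ∑-cong js (λ j → trans (sym (∑-*ˡ (c j) (allSubsets n) _)) (∑-cong (allSubsets n) (λ A → sym (∑-*ˡ (c j) (allSubsets n) _)))) ⟩
    ∑[ j ← js ] ∑[ A ← allSubsets n ] ∑[ A′ ← allSubsets n ] (c j * (⟦ guard A A′ ⟧ * F j A A′))
  ≡⟨ ∑-comm js (allSubsets n) _ ⟩
    ∑[ A ← allSubsets n ] ∑[ j ← js ] ∑[ A′ ← allSubsets n ] (c j * (⟦ guard A A′ ⟧ * F j A A′))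
  ≡⟨ ∑-cong (allSubsets n) (λ A → ∑-comm js (allSubsets n) _) ⟩
    ∑[ A ← allSubsets n ] ∑[ A′ ← allSubsets n ] ∑[ j ← js ] (c j * (⟦ guard A A′ ⟧ * F j A A′))
  ≡⟨ ∑-cong (allSubsets n) (λ A → ∑-cong (allSubsets n) (λ A′ →
       trans (∑-cong js (λ j → exchange (c j) ⟦ guard A A′ ⟧ (F j A A′))) (∑-*ˡ ⟦ guard A A′ ⟧ js _))) ⟩
    ∑-disjointPairs U (λ A A′ → ∑[ j ← js ] (c j * F j A A′))
  ∎
  where
  open ≡-Reasoning
  guard : Subset n → Subset n → Bool
  guard A A′ = A ⊆ᵇ U ∧ A′ ⊆ᵇ (U ∖ A)
  exchange : ∀ p q w → p * (q * w) ≡ q * (p * w)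
  exchange = solve-∀

module _ {n : ℕ} (D : Subset n → Bool) where

  -- (ζ̄ ∗ ζ)(K) for the characters ζ J = D J and ζ̄ J = (-1)^|J| D J.
  signedSplits : Subset n → ℤ
  signedSplits K = ∑[ A ← allSubsets n ] (⟦ A ⊆ᵇ K ⟧ * (sign ∣ A ∣ * ⟦ D A ∧ D (K ∖ A) ⟧))

  twoPartsWeight : ℕ → ℕ → List ℕ → Subset n → Subset n → Subset n → ℤ
  twoPartsWeight b c ys U A A′ = ⟦ (∣ A ∣ ≡ᵇ b) ∧ D A ⟧ * (⟦ (∣ A′ ∣ ≡ᵇ c) ∧ D A′ ⟧ * zetaOn D ((U ∖ A) ∖ A′) ys)

  zetaOn-twoParts : (b c : ℕ) (U : Subset n) (ys : List ℕ) →
    zetaOn D U (b ∷ c ∷ ys) ≡ ∑-disjointPairs U (twoPartsWeight b c ys U)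
  zetaOn-twoParts b c U ys =
    trans (zetaOn-∷ D U b (c ∷ ys)) (∑-cong (allSubsets n) (λ A →
      trans (cong (⟦ A ⊆ᵇ U ∧ ((∣ A ∣ ≡ᵇ b) ∧ D A) ⟧ *_) (zetaOn-∷ D (U ∖ A) c ys))
            (trans (sym (∑-*ˡ ⟦ A ⊆ᵇ U ∧ ((∣ A ∣ ≡ᵇ b) ∧ D A) ⟧ (allSubsets n) _))
                   (∑-cong (allSubsets n) (regroup A)))))
    where
    regroup : (A A′ : Subset n) →
      ⟦ A ⊆ᵇ U ∧ ((∣ A ∣ ≡ᵇ b) ∧ D A) ⟧ * (⟦ A′ ⊆ᵇ (U ∖ A) ∧ ((∣ A′ ∣ ≡ᵇ c) ∧ D A′) ⟧ * zetaOn D ((U ∖ A) ∖ A′) ys)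
      ≡ ⟦ A ⊆ᵇ U ∧ A′ ⊆ᵇ (U ∖ A) ⟧ * twoPartsWeight b c ys U A A′
    regroup A A′ rewrite ⟦∧⟧ (A ⊆ᵇ U) ((∣ A ∣ ≡ᵇ b) ∧ D A) | ⟦∧⟧ (A′ ⊆ᵇ (U ∖ A)) ((∣ A′ ∣ ≡ᵇ c) ∧ D A′)
                       | ⟦∧⟧ (A ⊆ᵇ U) (A′ ⊆ᵇ (U ∖ A)) =
      lemma ⟦ A ⊆ᵇ U ⟧ ⟦ (∣ A ∣ ≡ᵇ b) ∧ D A ⟧ ⟦ A′ ⊆ᵇ (U ∖ A) ⟧ ⟦ (∣ A′ ∣ ≡ᵇ c) ∧ D A′ ⟧ (zetaOn D ((U ∖ A) ∖ A′) ys)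
      where
      lemma : ∀ s p s′ p′ z → s * p * (s′ * p′ * z) ≡ s * s′ * (p * (p′ * z))
      lemma = solve-∀

  ∑-sign-twoPartsWeight : (a : ℕ) (ys : List ℕ) (U K A : Subset n) → A ⊆ᵇ K ≡ true →
    ∑[ j ← upTo (suc a) ] (sign j * twoPartsWeight j (a ∸ j) ys U A (K ∖ A))
    ≡ ⟦ ∣ K ∣ ≡ᵇ a ⟧ * (sign ∣ A ∣ * (⟦ D A ∧ D (K ∖ A) ⟧ * zetaOn D (U ∖ K) ys))
  ∑-sign-twoPartsWeight a ys U K A A⊆K = begin
      ∑[ j ← upTo (suc a) ] (sign j * twoPartsWeight j (a ∸ j) ys U A (K ∖ A))
    ≡⟨ ∑-cong (upTo (suc a)) (λ j → regroup (sign j) (∣ A ∣ ≡ᵇ j) (D A) (∣ K ∖ A ∣ ≡ᵇ a ∸ j) (D (K ∖ A))) ⟩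
      ∑[ j ← upTo (suc a) ] (⟦ ∣ A ∣ ≡ᵇ j ⟧ * (⟦ ∣ K ∖ A ∣ ≡ᵇ a ∸ j ⟧ * (sign j * w)))
    ≡⟨ ∑-sizesOfTwoParts a ∣ A ∣ ∣ K ∖ A ∣ (λ j → sign j * w) ⟩
      ⟦ ∣ K ∖ A ∣ ℕ.+ ∣ A ∣ ≡ᵇ a ⟧ * (sign ∣ A ∣ * w)
    ≡⟨ cong (λ m → ⟦ m ≡ᵇ a ⟧ * (sign ∣ A ∣ * w)) (∣∖∣+∣∣ A K A⊆K) ⟩
      ⟦ ∣ K ∣ ≡ᵇ a ⟧ * (sign ∣ A ∣ * w)
    ≡⟨ cong (λ V → ⟦ ∣ K ∣ ≡ᵇ a ⟧ * (sign ∣ A ∣ * (⟦ D A ∧ D (K ∖ A) ⟧ * zetaOn D V ys))) (∖-∖ U A K A⊆K) ⟩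
      ⟦ ∣ K ∣ ≡ᵇ a ⟧ * (sign ∣ A ∣ * (⟦ D A ∧ D (K ∖ A) ⟧ * zetaOn D (U ∖ K) ys))
    ∎
    where
    open ≡-Reasoning
    z w : ℤ
    z = zetaOn D ((U ∖ A) ∖ (K ∖ A)) ys
    w = ⟦ D A ∧ D (K ∖ A) ⟧ * z
    regroup : ∀ s x d y d′ → s * (⟦ x ∧ d ⟧ * (⟦ y ∧ d′ ⟧ * z)) ≡ ⟦ x ⟧ * (⟦ y ⟧ * (s * (⟦ d ∧ d′ ⟧ * z)))
    regroup s x d y d′ rewrite ⟦∧⟧ x d | ⟦∧⟧ y d′ | ⟦∧⟧ d d′ = lemma s ⟦ x ⟧ ⟦ d ⟧ ⟦ y ⟧ ⟦ d′ ⟧ z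
      where
      lemma : ∀ s x d y d′ z → s * (x * d * (y * d′ * z)) ≡ x * (y * (s * (d * d′ * z)))
      lemma = solve-∀

  ∑-splitsOf-sign-twoPartsWeight : (a : ℕ) (ys : List ℕ) (U K : Subset n) →
    ∑[ A ← allSubsets n ] (⟦ A ⊆ᵇ K ⟧ * ∑[ j ← upTo (suc a) ] (sign j * twoPartsWeight j (a ∸ j) ys U A (K ∖ A)))
    ≡ ⟦ ∣ K ∣ ≡ᵇ a ⟧ * zetaOn D (U ∖ K) ys * signedSplits K
  ∑-splitsOf-sign-twoPartsWeight a ys U K =
    trans (∑-cong (allSubsets n) (λ A → trans (⟦⟧*-cong (A ⊆ᵇ K) (∑-sign-twoPartsWeight a ys U K A))
                                              (regroup ⟦ A ⊆ᵇ K ⟧ ⟦ ∣ K ∣ ≡ᵇ a ⟧ (sign ∣ A ∣) ⟦ D A ∧ D (K ∖ A) ⟧ (zetaOn D (U ∖ K) ys))))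
          (∑-*ˡ (⟦ ∣ K ∣ ≡ᵇ a ⟧ * zetaOn D (U ∖ K) ys) (allSubsets n) (λ A → ⟦ A ⊆ᵇ K ⟧ * (sign ∣ A ∣ * ⟦ D A ∧ D (K ∖ A) ⟧)))
    where
    regroup : ∀ i k s d z → i * (k * (s * (d * z))) ≡ k * z * (i * (s * d))
    regroup = solve-∀

  module _ (signedSplits-vanishes : ∀ K → 0 < ∣ K ∣ → signedSplits K ≡ 0ℤ) where

    ∑-alternating-twoParts : (a : ℕ) → 0 < a → (ys : List ℕ) (U : Subset n) →
      ∑[ j ← upTo (suc a) ] (sign j * zetaOn D U (j ∷ (a ∸ j) ∷ ys)) ≡ 0ℤ
    ∑-alternating-twoParts a 0<a ys U = begin
        ∑[ j ← upTo (suc a) ] (sign j * zetaOn D U (j ∷ (a ∸ j) ∷ ys))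
      ≡⟨ ∑-cong (upTo (suc a)) (λ j → cong (sign j *_) (zetaOn-twoParts j (a ∸ j) U ys)) ⟩
        ∑[ j ← upTo (suc a) ] (sign j * ∑-disjointPairs U (P j))
      ≡⟨ ∑-*ˡ-disjointPairs (upTo (suc a)) sign U P ⟩
        ∑-disjointPairs U F
      ≡⟨ ∑-disjointPairs≡∑-splits U F ⟩
        ∑-splits U F
      ≡⟨ ∑-zero (allSubsets n) (λ K → trans (cong (⟦ K ⊆ᵇ U ⟧ *_)
                                                  (trans (∑-splitsOf-sign-twoPartsWeight a ys U K) (vanish K (∣ K ∣ ≡ᵇ a) refl)))
                                            (*-zeroʳ ⟦ K ⊆ᵇ U ⟧)) ⟩
        0ℤ
      ∎
      where
      open ≡-Reasoning
      P : ℕ → Subset n → Subset n → ℤ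
      P j = twoPartsWeight j (a ∸ j) ys U
      F : Subset n → Subset n → ℤ
      F A A′ = ∑[ j ← upTo (suc a) ] (sign j * P j A A′)
      vanish : (K : Subset n) (b : Bool) → (∣ K ∣ ≡ᵇ a) ≡ b → ⟦ b ⟧ * zetaOn D (U ∖ K) ys * signedSplits K ≡ 0ℤ
      vanish K false _ = trans (cong (_* signedSplits K) (*-zeroˡ (zetaOn D (U ∖ K) ys))) (*-zeroˡ (signedSplits K))
      vanish K true ∣K∣≡a = trans (cong (1ℤ * zetaOn D (U ∖ K) ys *_)
                                        (signedSplits-vanishes K (subst (0 <_) (sym (≡ᵇ-≡ ∣ K ∣ a ∣K∣≡a)) 0<a)))
                                  (*-zeroʳ (1ℤ * zetaOn D (U ∖ K) ys))

    ∑-alternating : (xs ys : List ℕ) (a : ℕ) → 0 < a → (U : Subset n) →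
      ∑[ j ← upTo (suc a) ] (sign j * zetaOn D U (xs ++ j ∷ (a ∸ j) ∷ ys)) ≡ 0ℤ
    ∑-alternating [] ys a 0<a U = ∑-alternating-twoParts a 0<a ys U
    ∑-alternating (x ∷ xs) ys a 0<a U = begin
        ∑[ j ← upTo (suc a) ] (sign j * zetaOn D U (x ∷ xs ++ j ∷ (a ∸ j) ∷ ys))
      ≡⟨ ∑-cong (upTo (suc a)) (λ j → trans (cong (sign j *_) (zetaOn-∷ D U x (xs ++ j ∷ (a ∸ j) ∷ ys)))
                                            (sym (∑-*ˡ (sign j) (allSubsets n) _))) ⟩
        ∑[ j ← upTo (suc a) ] ∑[ A ← allSubsets n ] (sign j * (c A * zetaOn D (U ∖ A) (xs ++ j ∷ (a ∸ j) ∷ ys)))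
      ≡⟨ ∑-comm (upTo (suc a)) (allSubsets n) _ ⟩
        ∑[ A ← allSubsets n ] ∑[ j ← upTo (suc a) ] (sign j * (c A * zetaOn D (U ∖ A) (xs ++ j ∷ (a ∸ j) ∷ ys)))
      ≡⟨ ∑-zero (allSubsets n) (λ A →
           trans (∑-cong (upTo (suc a)) (λ j → exchange (sign j) (c A) (zetaOn D (U ∖ A) (xs ++ j ∷ (a ∸ j) ∷ ys))))
                 (trans (∑-*ˡ (c A) (upTo (suc a)) _)
                        (trans (cong (c A *_) (∑-alternating xs ys a 0<a (U ∖ A))) (*-zeroʳ (c A))))) ⟩
        0ℤ
      ∎
      where
      open ≡-Reasoning
      c : Subset n → ℤ
      c A = ⟦ A ⊆ᵇ U ∧ ((∣ A ∣ ≡ᵇ x) ∧ D A) ⟧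
      exchange : ∀ p q w → p * (q * w) ≡ q * (p * w)
      exchange = solve-∀

-- The Möbius function ζ⁻¹

∑-⊆ᵇ-sign-∖ : {n : ℕ} (J : Subset n) → 0 < ∣ J ∣ → ∑[ A ← allSubsets n ] (⟦ A ⊆ᵇ J ⟧ * sign ∣ J ∖ A ∣) ≡ 0ℤ
∑-⊆ᵇ-sign-∖ {suc n} (true ∷ J) _ =
  trans (∑-allSubsets-suc n (λ A → ⟦ A ⊆ᵇ (true ∷ J) ⟧ * sign ∣ (true ∷ J) ∖ A ∣))
        (∑-zero (allSubsets n) (λ A → cancel ⟦ A ⊆ᵇ J ⟧ (sign ∣ J ∖ A ∣)))
  where
  cancel : ∀ x s → x * - s + x * s ≡ 0ℤ
  cancel = solve-∀
∑-⊆ᵇ-sign-∖ {suc n} (false ∷ J) 0<∣J∣ =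
  trans (∑-allSubsets-suc n (λ A → ⟦ A ⊆ᵇ (false ∷ J) ⟧ * sign ∣ (false ∷ J) ∖ A ∣))
        (trans (∑-cong (allSubsets n) (λ A → trans (cong (_+_ (⟦ A ⊆ᵇ J ⟧ * sign ∣ J ∖ A ∣))
                                                         (*-zeroˡ (sign ∣ (false ∷ J) ∖ (true ∷ A) ∣)))
                                                   (+-identityʳ _)))
               (∑-⊆ᵇ-sign-∖ J 0<∣J∣))

∑-⊆ᵇ-split⊥ : {n : ℕ} (U : Subset n) (p : Subset n → Bool) (f : Subset n → ℤ) →
  ∑[ A ← allSubsets n ] (⟦ A ⊆ᵇ U ∧ p A ⟧ * f A)
  ≡ ⟦ p ⊥ ⟧ * f ⊥ + ∑[ A ← allSubsets n ] (⟦ A ⊆ᵇ U ∧ (not (∣ A ∣ ≡ᵇ 0) ∧ p A) ⟧ * f A)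
∑-⊆ᵇ-split⊥ {n} U p f = begin
    ∑[ A ← allSubsets n ] (⟦ A ⊆ᵇ U ∧ p A ⟧ * f A)
  ≡⟨ ∑-cong (allSubsets n) (λ A →
       trans (cong (_* f A) (split (A ⊆ᵇ U) (∣ A ∣ ≡ᵇ 0) (p A)))
             (trans (*-distribʳ-+ (f A) (⟦ ∣ A ∣ ≡ᵇ 0 ⟧ * ⟦ A ⊆ᵇ U ∧ p A ⟧) ⟦ A ⊆ᵇ U ∧ (not (∣ A ∣ ≡ᵇ 0) ∧ p A) ⟧)
                    (cong (_+ nonempty A) (*-assoc ⟦ ∣ A ∣ ≡ᵇ 0 ⟧ ⟦ A ⊆ᵇ U ∧ p A ⟧ (f A))))) ⟩
    ∑[ A ← allSubsets n ] (⟦ ∣ A ∣ ≡ᵇ 0 ⟧ * (⟦ A ⊆ᵇ U ∧ p A ⟧ * f A) + nonempty A)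
  ≡⟨ ∑-+ (allSubsets n) (λ A → ⟦ ∣ A ∣ ≡ᵇ 0 ⟧ * (⟦ A ⊆ᵇ U ∧ p A ⟧ * f A)) nonempty ⟩
    ∑[ A ← allSubsets n ] (⟦ ∣ A ∣ ≡ᵇ 0 ⟧ * (⟦ A ⊆ᵇ U ∧ p A ⟧ * f A)) + ∑ (allSubsets n) nonempty
  ≡⟨ cong (_+ ∑ (allSubsets n) nonempty) (∑-⟦∣∣≡ᵇ0⟧* n (λ A → ⟦ A ⊆ᵇ U ∧ p A ⟧ * f A)) ⟩
    ⟦ ⊥ ⊆ᵇ U ∧ p ⊥ ⟧ * f ⊥ + ∑ (allSubsets n) nonempty
  ≡⟨ cong (λ b → ⟦ b ∧ p ⊥ ⟧ * f ⊥ + ∑ (allSubsets n) nonempty) (⊥⊆ᵇ U) ⟩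
    ⟦ p ⊥ ⟧ * f ⊥ + ∑ (allSubsets n) nonempty
  ∎
  where
  open ≡-Reasoning
  nonempty : Subset n → ℤ
  nonempty A = ⟦ A ⊆ᵇ U ∧ (not (∣ A ∣ ≡ᵇ 0) ∧ p A) ⟧ * f A
  split : ∀ s z d → ⟦ s ∧ d ⟧ ≡ ⟦ z ⟧ * ⟦ s ∧ d ⟧ + ⟦ s ∧ (not z ∧ d) ⟧
  split false z d = sym (trans (+-identityʳ _) (*-zeroʳ ⟦ z ⟧))
  split true true d = sym (trans (+-identityʳ _) (*-identityˡ ⟦ d ⟧))
  split true false d = sym (trans (cong (_+ ⟦ d ⟧) (*-zeroˡ ⟦ d ⟧)) (+-identityˡ ⟦ d ⟧))

∑-nonempty-⊆ᵇ-sign-∖ : {n : ℕ} (J : Subset n) → 0 < ∣ J ∣ →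
  ∑[ A ← allSubsets n ] (⟦ A ⊆ᵇ J ∧ (not (∣ A ∣ ≡ᵇ 0) ∧ true) ⟧ * sign ∣ J ∖ A ∣) ≡ - sign ∣ J ∣
∑-nonempty-⊆ᵇ-sign-∖ {n} J 0<∣J∣ = begin
    X
  ≡⟨ solve-for-X (sign ∣ J ∣) X ⟩
    (1ℤ * sign ∣ J ∣ + X) + - sign ∣ J ∣
  ≡⟨ cong (λ V → (1ℤ * sign ∣ V ∣ + X) + - sign ∣ J ∣) (sym (∖-⊥ J)) ⟩
    (1ℤ * sign ∣ J ∖ ⊥ ∣ + X) + - sign ∣ J ∣
  ≡⟨ cong (_+ - sign ∣ J ∣) (sym (∑-⊆ᵇ-split⊥ J (λ _ → true) (λ A → sign ∣ J ∖ A ∣))) ⟩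
    ∑[ A ← allSubsets n ] (⟦ A ⊆ᵇ J ∧ true ⟧ * sign ∣ J ∖ A ∣) + - sign ∣ J ∣
  ≡⟨ cong (_+ - sign ∣ J ∣) (trans (∑-cong (allSubsets n) (λ A → cong (λ b → ⟦ b ⟧ * sign ∣ J ∖ A ∣) (Boolₚ.∧-identityʳ (A ⊆ᵇ J))))
                                   (∑-⊆ᵇ-sign-∖ J 0<∣J∣)) ⟩
    0ℤ + - sign ∣ J ∣
  ≡⟨ +-identityˡ _ ⟩
    - sign ∣ J ∣
  ∎
  where
  open ≡-Reasoning
  X : ℤ
  X = ∑[ A ← allSubsets n ] (⟦ A ⊆ᵇ J ∧ (not (∣ A ∣ ≡ᵇ 0) ∧ true) ⟧ * sign ∣ J ∖ A ∣)
  solve-for-X : ∀ s x → x ≡ (1ℤ * s + x) + - s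
  solve-for-X = solve-∀

module _ {n : ℕ} (D : Subset n → Bool) where

  #nonemptyDecomp : Subset n → ℕ → ℤ
  #nonemptyDecomp U k = #decomp {l = k} U (λ _ J → not (∣ J ∣ ≡ᵇ 0) ∧ D J)

  nonemptyPart : Subset n → Subset n → Bool
  nonemptyPart U A = A ⊆ᵇ U ∧ (not (∣ A ∣ ≡ᵇ 0) ∧ D A)

  #nonemptyDecomp-suc : (U : Subset n) (k : ℕ) →
    #nonemptyDecomp U (suc k) ≡ ∑[ A ← allSubsets n ] (⟦ nonemptyPart U A ⟧ * #nonemptyDecomp (U ∖ A) k)
  #nonemptyDecomp-suc U k = #decomp-suc U (λ _ J → not (∣ J ∣ ≡ᵇ 0) ∧ D J)

  ∣∖nonemptyPart∣< : (U A : Subset n) → nonemptyPart U A ≡ true → ∣ U ∖ A ∣ < ∣ U ∣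
  ∣∖nonemptyPart∣< U A part with A ⊆ᵇ U in A⊆U | ∣ A ∣ in ∣A∣
  ... | true | suc _ = ∣∖∣<∣∣ A U A⊆U (subst (0 <_) (sym ∣A∣) (s≤s z≤n))

  #nonemptyDecomp-> : (k : ℕ) (U : Subset n) → ∣ U ∣ < k → #nonemptyDecomp U k ≡ 0ℤ
  #nonemptyDecomp-> (suc k) U ∣U∣<1+k = trans (#nonemptyDecomp-suc U k) (∑-zero (allSubsets n) (λ A →
    trans (⟦⟧*-cong (nonemptyPart U A) (λ part → #nonemptyDecomp-> k (U ∖ A) (ℕₚ.<-≤-trans (∣∖nonemptyPart∣< U A part) (ℕₚ.≤-pred ∣U∣<1+k))))
          (*-zeroʳ ⟦ nonemptyPart U A ⟧)))

  -- ζ⁻¹ on the subsets of X; terms with k > |U| vanish, so summing up to n is harmless.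
  möbius : Subset n → ℤ
  möbius U = ∑[ k ← upTo (suc n) ] (sign k * #nonemptyDecomp U k)

  möbius-trunc : (U : Subset n) (M : ℕ) → ∣ U ∣ < M → M ≤ suc n →
    möbius U ≡ ∑[ k ← upTo M ] (sign k * #nonemptyDecomp U k)
  möbius-trunc U M ∣U∣<M M≤1+n = ∑-trunc (suc n) M _ M≤1+n (λ k M≤k →
    trans (cong (sign k *_) (#nonemptyDecomp-> k U (ℕₚ.<-≤-trans ∣U∣<M M≤k))) (*-zeroʳ (sign k)))

  möbius-⊥ : (U : Subset n) → ∣ U ∣ ≡ 0 → möbius U ≡ 1ℤ
  möbius-⊥ U ∣U∣≡0 = begin
      möbius U
    ≡⟨ möbius-trunc U 1 (s≤s (ℕₚ.≤-reflexive ∣U∣≡0)) (s≤s z≤n) ⟩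
      1ℤ * #nonemptyDecomp U 0 + 0ℤ
    ≡⟨ cong (λ x → 1ℤ * x + 0ℤ) (trans (#decomp-zero U (λ _ J → not (∣ J ∣ ≡ᵇ 0) ∧ D J)) (cong (λ m → ⟦ m ≡ᵇ 0 ⟧) ∣U∣≡0)) ⟩
      1ℤ
    ∎
    where open ≡-Reasoning

  möbius-rec : (U : Subset n) → 0 < ∣ U ∣ →
    möbius U ≡ - ∑[ A ← allSubsets n ] (⟦ nonemptyPart U A ⟧ * möbius (U ∖ A))
  möbius-rec U 0<∣U∣ = begin
      möbius U
    ≡⟨ ∑-upTo-suc n (λ k → sign k * #nonemptyDecomp U k) ⟩
      1ℤ * #nonemptyDecomp U 0 + ∑[ k ← upTo n ] (sign (suc k) * #nonemptyDecomp U (suc k))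
    ≡⟨ cong₂ _+_ (trans (cong (1ℤ *_) (trans (#decomp-zero U (λ _ J → not (∣ J ∣ ≡ᵇ 0) ∧ D J))
                                             (cong ⟦_⟧ (≢ᵇ-< ∣ U ∣ 0 0<∣U∣))))
                        (*-zeroʳ 1ℤ))
                 (∑-cong (upTo n) peel) ⟩
      0ℤ + ∑[ k ← upTo n ] (- ∑[ A ← allSubsets n ] (sign k * (⟦ nonemptyPart U A ⟧ * #nonemptyDecomp (U ∖ A) k)))
    ≡⟨ trans (+-identityˡ _) (∑-neg (upTo n) _) ⟩
      - ∑[ k ← upTo n ] ∑[ A ← allSubsets n ] (sign k * (⟦ nonemptyPart U A ⟧ * #nonemptyDecomp (U ∖ A) k))
    ≡⟨ cong -_ (∑-comm (upTo n) (allSubsets n) _) ⟩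
      - ∑[ A ← allSubsets n ] ∑[ k ← upTo n ] (sign k * (⟦ nonemptyPart U A ⟧ * #nonemptyDecomp (U ∖ A) k))
    ≡⟨ cong -_ (∑-cong (allSubsets n) (λ A →
         trans (∑-cong (upTo n) (λ k → exchange (sign k) ⟦ nonemptyPart U A ⟧ (#nonemptyDecomp (U ∖ A) k)))
               (trans (∑-*ˡ ⟦ nonemptyPart U A ⟧ (upTo n) (λ k → sign k * #nonemptyDecomp (U ∖ A) k))
                      (⟦⟧*-cong (nonemptyPart U A) (λ part → sym (möbius-trunc (U ∖ A) n
                         (ℕₚ.<-≤-trans (∣∖nonemptyPart∣< U A part) (∣p∣≤n U)) (ℕₚ.n≤1+n n))))))) ⟩
      - ∑[ A ← allSubsets n ] (⟦ nonemptyPart U A ⟧ * möbius (U ∖ A))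
    ∎
    where
    open ≡-Reasoning
    exchange : ∀ p q w → p * (q * w) ≡ q * (p * w)
    exchange = solve-∀
    peel : ∀ k → sign (suc k) * #nonemptyDecomp U (suc k)
                 ≡ - ∑[ A ← allSubsets n ] (sign k * (⟦ nonemptyPart U A ⟧ * #nonemptyDecomp (U ∖ A) k))
    peel k = trans (cong (- sign k *_) (#nonemptyDecomp-suc U k))
                   (trans (sym (neg-distribˡ-* (sign k) _)) (cong -_ (sym (∑-*ˡ (sign k) (allSubsets n) _))))

  module _ (D⊥ : D ⊥ ≡ true) where

    ∑-D-möbius-∖ : (U : Subset n) → 0 < ∣ U ∣ → ∑[ A ← allSubsets n ] (⟦ A ⊆ᵇ U ∧ D A ⟧ * möbius (U ∖ A)) ≡ 0ℤ
    ∑-D-möbius-∖ U 0<∣U∣ = begin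
        ∑[ A ← allSubsets n ] (⟦ A ⊆ᵇ U ∧ D A ⟧ * möbius (U ∖ A))
      ≡⟨ ∑-⊆ᵇ-split⊥ U D (λ A → möbius (U ∖ A)) ⟩
        ⟦ D ⊥ ⟧ * möbius (U ∖ ⊥) + ∑[ A ← allSubsets n ] (⟦ nonemptyPart U A ⟧ * möbius (U ∖ A))
      ≡⟨ cong₂ (λ b V → ⟦ b ⟧ * möbius V + ∑[ A ← allSubsets n ] (⟦ nonemptyPart U A ⟧ * möbius (U ∖ A))) D⊥ (∖-⊥ U) ⟩
        1ℤ * möbius U + ∑[ A ← allSubsets n ] (⟦ nonemptyPart U A ⟧ * möbius (U ∖ A))
      ≡⟨ cong₂ _+_ (*-identityˡ (möbius U)) (trans (sym (neg-involutive _)) (cong -_ (sym (möbius-rec U 0<∣U∣)))) ⟩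
        möbius U + - möbius U
      ≡⟨ +-inverseʳ (möbius U) ⟩
        0ℤ
      ∎
      where open ≡-Reasoning

  module _ (hereditary : ∀ A J → D J ≡ true → A ⊆ᵇ J ≡ true → D A ≡ true)
           (eulerian : ∀ J → D J ≡ true ⊎ möbius J ≡ 0ℤ) where

    nonemptyPart-of-D : (J A : Subset n) → D J ≡ true →
      nonemptyPart J A ≡ (A ⊆ᵇ J ∧ (not (∣ A ∣ ≡ᵇ 0) ∧ true))
    nonemptyPart-of-D J A DJ with A ⊆ᵇ J in A⊆J
    ... | false = refl
    ... | true rewrite hereditary A J DJ A⊆J = refl

    möbius≡sign : (m : ℕ) (J : Subset n) → ∣ J ∣ ≤ m → möbius J ≡ sign ∣ J ∣ * ⟦ D J ⟧
    möbius≡sign m J ∣J∣≤m with D J in DJ | eulerian J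
    ... | false | inj₂ möbius≡0 = trans möbius≡0 (sym (*-zeroʳ (sign ∣ J ∣)))
    ... | true | _ with ∣ J ∣ ℕ.≟ 0
    ...   | yes ∣J∣≡0 = trans (möbius-⊥ J ∣J∣≡0) (cong (λ k → sign k * 1ℤ) (sym ∣J∣≡0))
    möbius≡sign zero J ∣J∣≤0 | true | _ | no ∣J∣≢0 = contradiction (ℕₚ.n≤0⇒n≡0 ∣J∣≤0) ∣J∣≢0
    möbius≡sign (suc m) J ∣J∣≤1+m | true | _ | no ∣J∣≢0 = begin
        möbius J
      ≡⟨ möbius-rec J 0<∣J∣ ⟩
        - ∑[ A ← allSubsets n ] (⟦ nonemptyPart J A ⟧ * möbius (J ∖ A))
      ≡⟨ cong -_ (∑-cong (allSubsets n) (λ A →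
           trans (⟦⟧*-cong (nonemptyPart J A) (smaller-part A))
                 (cong (λ b → ⟦ b ⟧ * sign ∣ J ∖ A ∣) (nonemptyPart-of-D J A DJ)))) ⟩
        - ∑[ A ← allSubsets n ] (⟦ A ⊆ᵇ J ∧ (not (∣ A ∣ ≡ᵇ 0) ∧ true) ⟧ * sign ∣ J ∖ A ∣)
      ≡⟨ cong -_ (∑-nonempty-⊆ᵇ-sign-∖ J 0<∣J∣) ⟩
        - - sign ∣ J ∣
      ≡⟨ trans (neg-involutive _) (sym (*-identityʳ _)) ⟩
        sign ∣ J ∣ * 1ℤ
      ∎
      where
      open ≡-Reasoning
      0<∣J∣ : 0 < ∣ J ∣
      0<∣J∣ = ℕₚ.n≢0⇒n>0 ∣J∣≢0
      smaller-part : (A : Subset n) → nonemptyPart J A ≡ true → möbius (J ∖ A) ≡ sign ∣ J ∖ A ∣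
      smaller-part A part =
        trans (möbius≡sign m (J ∖ A) (ℕₚ.≤-pred (ℕₚ.<-≤-trans (∣∖nonemptyPart∣< J A part) ∣J∣≤1+m)))
              (trans (cong (λ b → sign ∣ J ∖ A ∣ * ⟦ b ⟧) (hereditary (J ∖ A) J DJ (∖-⊆ᵇ J A)))
                     (*-identityʳ _))

    signedSplits-vanishes : D ⊥ ≡ true → (K : Subset n) → 0 < ∣ K ∣ → signedSplits D K ≡ 0ℤ
    signedSplits-vanishes D⊥ K 0<∣K∣ = begin
        signedSplits D K
      ≡⟨ ∑-cong (allSubsets n) term ⟩
        ∑[ A ← allSubsets n ] (sign ∣ K ∣ * (⟦ A ⊆ᵇ K ∧ D A ⟧ * möbius (K ∖ A)))
      ≡⟨ ∑-*ˡ (sign ∣ K ∣) (allSubsets n) _ ⟩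
        sign ∣ K ∣ * ∑[ A ← allSubsets n ] (⟦ A ⊆ᵇ K ∧ D A ⟧ * möbius (K ∖ A))
      ≡⟨ cong (sign ∣ K ∣ *_) (∑-D-möbius-∖ D⊥ K 0<∣K∣) ⟩
        sign ∣ K ∣ * 0ℤ
      ≡⟨ *-zeroʳ (sign ∣ K ∣) ⟩
        0ℤ
      ∎
      where
      open ≡-Reasoning
      sign-∣∣ : (A : Subset n) → A ⊆ᵇ K ≡ true → sign ∣ A ∣ ≡ sign ∣ K ∣ * sign ∣ K ∖ A ∣
      sign-∣∣ A A⊆K = sym (begin
          sign ∣ K ∣ * sign ∣ K ∖ A ∣
        ≡⟨ cong (λ k → sign k * sign ∣ K ∖ A ∣) (sym (∣∖∣+∣∣ A K A⊆K)) ⟩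
          sign (∣ K ∖ A ∣ ℕ.+ ∣ A ∣) * sign ∣ K ∖ A ∣
        ≡⟨ cong (_* sign ∣ K ∖ A ∣) (sign-+ ∣ K ∖ A ∣ ∣ A ∣) ⟩
          sign ∣ K ∖ A ∣ * sign ∣ A ∣ * sign ∣ K ∖ A ∣
        ≡⟨ regroup (sign ∣ K ∖ A ∣) (sign ∣ A ∣) ⟩
          sign ∣ K ∖ A ∣ * sign ∣ K ∖ A ∣ * sign ∣ A ∣
        ≡⟨ trans (cong (_* sign ∣ A ∣) (sign-*-sign ∣ K ∖ A ∣)) (*-identityˡ (sign ∣ A ∣)) ⟩
          sign ∣ A ∣
        ∎)
        where
        regroup : ∀ x a → x * a * x ≡ x * x * a
        regroup = solve-∀
      term : (A : Subset n) → ⟦ A ⊆ᵇ K ⟧ * (sign ∣ A ∣ * ⟦ D A ∧ D (K ∖ A) ⟧)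
                              ≡ sign ∣ K ∣ * (⟦ A ⊆ᵇ K ∧ D A ⟧ * möbius (K ∖ A))
      term A with A ⊆ᵇ K in A⊆K
      ... | false = trans (*-zeroˡ (sign ∣ A ∣ * ⟦ D A ∧ D (K ∖ A) ⟧)) (sym (trans (cong (sign ∣ K ∣ *_) (*-zeroˡ (möbius (K ∖ A)))) (*-zeroʳ (sign ∣ K ∣))))
      ... | true = begin
          1ℤ * (sign ∣ A ∣ * ⟦ D A ∧ D (K ∖ A) ⟧)
        ≡⟨ cong₂ (λ s d → 1ℤ * (s * d)) (sign-∣∣ A A⊆K) (⟦∧⟧ (D A) (D (K ∖ A))) ⟩
          1ℤ * (sign ∣ K ∣ * sign ∣ K ∖ A ∣ * (⟦ D A ⟧ * ⟦ D (K ∖ A) ⟧))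
        ≡⟨ regroup (sign ∣ K ∣) (sign ∣ K ∖ A ∣) ⟦ D A ⟧ ⟦ D (K ∖ A) ⟧ ⟩
          sign ∣ K ∣ * (⟦ D A ⟧ * (sign ∣ K ∖ A ∣ * ⟦ D (K ∖ A) ⟧))
        ≡⟨ cong (λ x → sign ∣ K ∣ * (⟦ D A ⟧ * x)) (sym (möbius≡sign n (K ∖ A) (∣p∣≤n (K ∖ A)))) ⟩
          sign ∣ K ∣ * (⟦ D A ⟧ * möbius (K ∖ A))
        ∎
        where
        regroup : ∀ sK sX dA dX → 1ℤ * (sK * sX * (dA * dX)) ≡ sK * (dA * (sX * dX))
        regroup = solve-∀

möbius-positive : {n : ℕ} (D : Subset n → Bool) (U : Subset n) (m : ℕ) → ∣ U ∣ ≡ suc m →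
  möbius D U ≡ ∑[ k ← upTo (suc m) ] (sign (suc k) * #nonemptyDecomp D U (suc k))
möbius-positive {n} D U m ∣U∣≡1+m = begin
    möbius D U
  ≡⟨ möbius-trunc D U (suc (suc m)) (s≤s (ℕₚ.≤-reflexive ∣U∣≡1+m)) (s≤s (subst (_≤ n) ∣U∣≡1+m (∣p∣≤n U))) ⟩
    ∑[ k ← upTo (suc (suc m)) ] (sign k * #nonemptyDecomp D U k)
  ≡⟨ ∑-upTo-suc (suc m) (λ k → sign k * #nonemptyDecomp D U k) ⟩
    1ℤ * #nonemptyDecomp D U 0 + ∑[ k ← upTo (suc m) ] (sign (suc k) * #nonemptyDecomp D U (suc k))
  ≡⟨ cong (λ x → 1ℤ * x + ∑[ k ← upTo (suc m) ] (sign (suc k) * #nonemptyDecomp D U (suc k)))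
          (trans (#decomp-zero U (λ _ J → not (∣ J ∣ ≡ᵇ 0) ∧ D J)) (cong (λ k → ⟦ k ≡ᵇ 0 ⟧) ∣U∣≡1+m)) ⟩
    1ℤ * 0ℤ + ∑[ k ← upTo (suc m) ] (sign (suc k) * #nonemptyDecomp D U (suc k))
  ≡⟨ +-identityˡ _ ⟩
    ∑[ k ← upTo (suc m) ] (sign (suc k) * #nonemptyDecomp D U (suc k))
  ∎
  where open ≡-Reasoning

support≡ᵇ-lookup : {n k : ℕ} (g : Vec (Fin (suc k)) n) (J : Subset n) →
  allᵇ (λ x → ⌊ lookup J x Bool.≟ inside ⌋ ∧ not ⌊ lookup g x Fin.≟ zero ⌋
              ∨ (⌊ lookup J x Bool.≟ outside ⌋ ∧ ⌊ lookup g x Fin.≟ zero ⌋)) (allFin n)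
  ≡ support≡ᵇ g J
support≡ᵇ-lookup [] [] = refl
support≡ᵇ-lookup (b ∷ g) (u ∷ J) =
  trans (allᵇ-allFin-suc (λ x → clause (lookup (u ∷ J) x) (lookup (b ∷ g) x)))
        (cong₂ _∧_ (coordinate u b) (support≡ᵇ-lookup g J))
  where
  clause : ∀ {k} → Bool → Fin (suc k) → Bool
  clause u b = ⌊ u Bool.≟ inside ⌋ ∧ not ⌊ b Fin.≟ zero ⌋ ∨ (⌊ u Bool.≟ outside ⌋ ∧ ⌊ b Fin.≟ zero ⌋)
  coordinate : ∀ {k} u (b : Fin (suc k)) → clause u b ≡ nonzero⇔ b u
  coordinate true zero = refl
  coordinate true (suc b) = refl
  coordinate false zero = refl
  coordinate false (suc b) = refl

+Nk≡#nonemptyDecomp : {n : ℕ} (B : Subset n → Bool) (J : Subset n) (k : ℕ) →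
  + Nk B J k ≡ #nonemptyDecomp (discreteᵇ B) J k
+Nk≡#nonemptyDecomp {n} B J k = trans (+count≡∑ _ (allMaps n (suc k)))
  (∑-cong (allMaps n (suc k)) (λ g → cong (λ b → ⟦ b ∧ _ ⟧) (support≡ᵇ-lookup g J)))

zetaInv≡möbius : {n : ℕ} (B : Subset n → Bool) (J : Subset n) → zetaInv B J ≡ möbius (discreteᵇ B) J
zetaInv≡möbius B J with ∣ J ∣ in ∣J∣
... | zero = sym (möbius-⊥ (discreteᵇ B) J ∣J∣)
... | suc m = sym (trans (möbius-positive (discreteᵇ B) J m ∣J∣)
                         (∑-cong (upTo (suc m)) (λ k → cong (sign (suc k) *_) (sym (+Nk≡#nonemptyDecomp B J (suc k))))))

theorem6 : (n : ℕ) (B : Subset n → Bool) → IsBuildingSet B → IsEulerian B →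
    (α : List ℕ) → IsComposition n α → (i : Fin (length α)) →
    altSum B α i ≡ + 0
theorem6 n B _ eulerian α (positive , _) i = begin
    altSum B α i
  ≡⟨ ∑-cong (upTo (suc a)) (λ j → cong (sign j *_) (trans (+zeta≡zetaOn⊤ B (splitAt α i j))
                                                          (zetaOn-filter-positive D (discreteᵇ-⊥ B) ⊤ (parts j)))) ⟩
    ∑[ j ← upTo (suc a) ] (sign j * zetaOn D ⊤ (parts j))
  ≡⟨ ∑-alternating D (signedSplits-vanishes D (discreteᵇ-⊆ B) eulerian′ (discreteᵇ-⊥ B))
                     (take (toℕ i) α) (drop (suc (toℕ i)) α) a (All.lookup positive (∈-lookup i)) ⊤ ⟩
    0ℤ
  ∎
  where
  open ≡-Reasoning
  D : Subset n → Bool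
  D = discreteᵇ B
  a : ℕ
  a = List.lookup α i
  parts : ℕ → List ℕ
  parts j = take (toℕ i) α ++ j ∷ (a ∸ j) ∷ drop (suc (toℕ i)) α
  eulerian′ : ∀ J → D J ≡ true ⊎ möbius D J ≡ 0ℤ
  eulerian′ J = Sum.map₂ (trans (sym (zetaInv≡möbius B J))) (eulerian J)
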